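{- Let $G$ be a finite connected graph with edges $e_1,\dots,e_m$, let $u\in V(G)$, and let $h_1,\dots,h_m$ be non-negative integers with $h=h_1+\dots+h_m$. Then there exist integers $k_1,\dots,k_m$ with $\tfrac12 h_i\le k_i\le\tfrac12 h_i+m$ for each $i$ such that $$W_G(h_1,\dots,h_m;u)\;\le\;(h+2m)^m\prod_{v\in V(G)}\binom{k^v_1+k^v_2+\dots+k^v_{\deg(v)}}{k^v_1,\,k^v_2,\,\dots,\,k^v_{\deg(v)}},$$ where for each vertex $v$, $e^v_1,\dots,e^v_{\deg(v)}$ are the edges incident to $v$ and $k^v_j$ is the $k_i$ with $e_i=e^v_j$.
   Context: A tour on a graph is a walk $v_0,f_1,v_1,\dots,f_\ell,v_\ell$ (each $f_i$ an edge with endvertices $v_{i-1},v_i$) with $v_\ell=v_0$; it starts and ends at $v_0$. $W_G(h_1,\dots,h_m;u)$ denotes the number of tours on $G$ starting and ending at $u$ that traverse each edge $e_i$ exactly $h_i$ times (in total, in either direction). $\binom{n}{a_1,\dots,a_r}=\frac{n!}{a_1!\cdots a_r!}$ for $n=a_1+\dots+a_r$ is the multinomial coefficient. -}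

module Defs where

open import Data.Nat using (ℕ; zero; suc; _+_; _*_; _^_; _≤_; NonZero; _!)
open import Data.Nat.Properties using (_!≢0; m*n≢0)
open import Data.Nat.DivMod using (_/_)
open import Data.Fin using (Fin; _≟_)
open import Data.Fin.Base using () 
open import Data.Nat.ListAction using (sum; product)
open import Data.List using (List; []; _∷_; map; length; filter; concatMap; allFin; _++_)
open import Data.Vec.Functional using (Vector)
open import Data.Product using (_×_; _,_; proj₁; proj₂; Σ; ∃)
open import Data.Sum using (_⊎_)
open import Data.Bool using (Bool; true; false; _∧_; _∨_; T; T?)
open import Relation.Nullary.Decidable using (⌊_⌋)
open import Relation.Binary.PropositionalEquality using (_≡_)

-- A finite (multi)graph with vertex set Fin n and edge set Fin m = {e_1,...,e_m};
-- each edge has two (not necessarily distinct) endpoints.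
record Graph (n m : ℕ) : Set where
  field
    ends : Fin m → Fin n × Fin n
open Graph public

-- A step of a walk: an edge f_j together with the vertex v_j it leads to.
Step : ℕ → ℕ → Set
Step n m = Fin m × Fin n

_=ᵇ_ : ∀ {k} → Fin k → Fin k → Bool
a =ᵇ b = ⌊ a ≟ b ⌋

joins : ∀ {n m} → Graph n m → Fin m → Fin n → Fin n → Bool
joins G e a b with ends G e
... | (x , y) = ((x =ᵇ a) ∧ (y =ᵇ b)) ∨ ((x =ᵇ b) ∧ (y =ᵇ a))

-- isWalk G a s b: v_0 = a, f_1, v_1, ..., f_ℓ, v_ℓ (with s = [(f_1,v_1),...,(f_ℓ,v_ℓ)])
-- is a walk with v_ℓ = b
isWalk : ∀ {n m} → Graph n m → Fin n → List (Step n m) → Fin n → Bool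
isWalk G a [] b = a =ᵇ b
isWalk G a ((f , v) ∷ s) b = joins G f a v ∧ isWalk G v s b

IsWalk : ∀ {n m} → Graph n m → Fin n → List (Step n m) → Fin n → Set
IsWalk G a s b = T (isWalk G a s b)

Connected : ∀ {n m} → Graph n m → Set
Connected {n} {m} G = (a b : Fin n) → ∃ λ (s : List (Step n m)) → IsWalk G a s b

traversals : ∀ {n m} → Fin m → List (Step n m) → ℕ
traversals e [] = 0
traversals e ((f , _) ∷ s) with e ≟ f
... | Relation.Nullary.Decidable.yes _ = suc (traversals e s)
... | Relation.Nullary.Decidable.no  _ = traversals e s

allEq : ∀ {m} → (Fin m → ℕ) → (Fin m → ℕ) → Bool
allEq {m} f g = Data.List.foldr (λ i r → ⌊ f i Data.Nat.≟ g i ⌋ ∧ r) true (allFin m)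

allLists : ∀ {A : Set} → List A → ℕ → List (List A)
allLists xs zero = [] ∷ []
allLists xs (suc l) = concatMap (λ x → map (x ∷_) (allLists xs l)) xs

allSteps : (n m : ℕ) → List (Step n m)
allSteps n m = concatMap (λ e → map (e ,_) (allFin n)) (allFin m)

-- W_G(h_1,...,h_m; u): number of tours starting and ending at u traversing
-- each edge e_i exactly h_i times. Such a tour has length h = h_1+...+h_m.
W : ∀ {n m} → Graph n m → (Fin m → ℕ) → Fin n → ℕ
W {n} {m} G h u =
  length (filter (λ s → T? (isWalk G u s u ∧ allEq (λ i → traversals i s) h))
                 (allLists (allSteps n m) (sum (map h (allFin m)))))

-- incident G v : the list e^v_1, ..., e^v_{deg v} of edges incident to v
-- (a loop at v appears twice, so that its length is deg v).
incident : ∀ {n m} → Graph n m → Fin n → List (Fin m)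
incident {n} {m} G v = concatMap inc (allFin m)
  where
  inc : Fin m → List (Fin m)
  inc e with ends G e
  ... | (x , y) = (if x =ᵇ v then e ∷ [] else []) ++ (if y =ᵇ v then e ∷ [] else [])
    where open import Data.Bool using (if_then_else_)

productFact≢0 : (ks : List ℕ) → NonZero (product (map _! ks))
productFact≢0 [] = _
productFact≢0 (k ∷ ks) = m*n≢0 (k !) (product (map _! ks)) {{k !≢0}} {{productFact≢0 ks}}

multinomial : List ℕ → ℕ
multinomial ks = ((sum ks) ! / product (map _! ks)) {{productFact≢0 ks}}

total : ∀ {m} → (Fin m → ℕ) → ℕ
total {m} h = sum (map h (allFin m))

-- A tour is determined by its start together with, for every vertex w, the order in which it
-- leaves w along the edges at w.  Fix how often each edge eᵢ is traversed forwards (xᵢ) and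
-- backwards (hᵢ − xᵢ); there are ∏ (hᵢ + 1) ≤ (h + 2m)^m such profiles.  For a fixed profile,
-- the exit orders at w are counted by the multinomial coefficient of the exit counts at w, and,
-- reading the tour backwards, also by that of the entry counts.  A closed walk enters every
-- vertex as often as it leaves it, and at w the exit and entry counts along eᵢ add up to hᵢ;
-- since a product of factorials with fixed sum is smallest at the most balanced split, the
-- product of the two multinomials at w is at most the square of the multinomial of the
-- ⌈hᵢ/2⌉.  So kᵢ = ⌈hᵢ/2⌉ works.

module Submission where

open import Algebra.Bundles using (CommutativeMonoid)
open import Data.Bool using (Bool; true; false; _∧_; not; T; T?; if_then_else_)
open import Data.Empty using (⊥-elim)
open import Data.Fin using (Fin; zero; suc; _≟_)
open import Data.Fin.Properties using (punchInᵢ≢i; all?)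
open import Data.List using (List; []; _∷_; map; _++_; [_]; concatMap; allFin; foldr; filter; length; tabulate; upTo)
open import Data.List.Properties
  using (map-++; map-∘; map-tabulate; tabulate-cong; map-concatMap; concatMap-cong; length-upTo)
open import Data.List.Membership.Propositional using (_∈_)
open import Data.List.Membership.Propositional.Properties using (∈-allFin; ∈-upTo⁺; ∈-upTo⁻)
open import Data.List.Relation.Binary.Pointwise using (Pointwise; []; _∷_; map⁺)
import Data.List.Relation.Binary.Pointwise as PW
open import Data.List.Relation.Unary.Any using (here; there)
open import Data.Nat hiding (_≟_)
open import Data.Nat.DivMod using (m*n/n≡m)
open import Data.Nat.ListAction using (sum; product)
open import Data.Nat.ListAction.Properties using (sum-++; product-++)
open import Data.Nat.Properties hiding (_≟_)
open import Data.Nat.Properties using () renaming (_≟_ to _≟ℕ_)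
open import Data.Nat.Tactic.RingSolver using (solve-∀)
open import Data.Product using (Σ; _×_; _,_; proj₁; proj₂)
open import Data.Sum using (_⊎_; inj₁; inj₂)
import Data.Sum as Sum
open import Data.Unit using (tt)
open import Data.Vec.Functional using (updateAt; removeAt) renaming (_∷_ to _∷ᵛ_)
open import Data.Vec.Functional.Properties using (updateAt-updates; updateAt-minimal)
open import Function using (_∘_)
open import Relation.Binary.PropositionalEquality hiding ([_])
open import Relation.Nullary using (¬_; yes; no)
open import Relation.Nullary.Decidable using (⌊_⌋; toWitness; fromWitness)
open import Algebra.Properties.CommutativeSemigroup +-commutativeSemigroup
  using () renaming (interchange to +-interchange)
open import Algebra.Properties.CommutativeSemigroup *-commutativeSemigroup
  using () renaming (interchange to *-interchange)
open import Algebra.Properties.Semiring.Sum +-*-semiring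
  using (sum-replicate-zero; ∑-distrib-+; *-distribˡ-sum; *-distribʳ-sum)
  renaming (sum to ∑; sum-cong-≋ to ∑-cong; sum-remove to ∑-remove)
open import Algebra.Properties.CommutativeMonoid.Sum *-1-commutativeMonoid
  using () renaming (sum to ∏; sum-cong-≋ to ∏-cong; ∑-distrib-+ to ∏-distrib-*)
open import Defs

-- Binomial and multinomial coefficients

binom : ℕ → ℕ → ℕ
binom zero    b       = 1
binom (suc a) zero    = 1
binom (suc a) (suc b) = binom a (suc b) + binom (suc a) b

binom-factorial : ∀ a b → binom a b * (a ! * b !) ≡ (a + b) !
binom-factorial zero    b       = trans (*-identityˡ _) (*-identityˡ (b !))
binom-factorial (suc a) zero    = trans (*-identityˡ _) (trans (*-identityʳ _) (cong _! (sym (+-identityʳ (suc a)))))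
binom-factorial (suc a) (suc b) = begin
  (binom a (suc b) + binom (suc a) b) * (suc a ! * suc b !)
    ≡⟨ expand (binom a (suc b)) (binom (suc a) b) (a !) (b !) a b ⟩
  binom a (suc b) * (a ! * suc b !) * suc a + binom (suc a) b * (suc a ! * b !) * suc b
    ≡⟨ cong₂ (λ p q → p * suc a + q * suc b) (binom-factorial a (suc b))
             (trans (binom-factorial (suc a) b) (cong _! (sym (+-suc a b)))) ⟩
  (a + suc b) ! * suc a + (a + suc b) ! * suc b
    ≡⟨ sum-of-parts ((a + suc b) !) a b ⟩
  (suc a + suc b) ! ∎
  where
  open ≡-Reasoning
  expand : ∀ X Y F G a b → (X + Y) * ((F + a * F) * (G + b * G))
         ≡ X * (F * (G + b * G)) * suc a + Y * ((F + a * F) * G) * suc b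
  expand = solve-∀
  sum-of-parts : ∀ H a b → H * suc a + H * suc b ≡ H + (a + suc b) * H
  sum-of-parts = solve-∀

1≤binom : ∀ a b → 1 ≤ binom a b
1≤binom zero    b       = ≤-refl
1≤binom (suc a) zero    = ≤-refl
1≤binom (suc a) (suc b) = ≤-trans (1≤binom a (suc b)) (m≤m+n _ _)

binom-sucˡ : ∀ a b → binom a b ≤ binom (suc a) b
binom-sucˡ zero    zero    = ≤-refl
binom-sucˡ zero    (suc b) = 1≤binom 1 (suc b)
binom-sucˡ (suc a) zero    = ≤-refl
binom-sucˡ (suc a) (suc b) = m≤m+n _ _

binom-sucʳ : ∀ a b → binom a b ≤ binom a (suc b)
binom-sucʳ zero    b = ≤-refl
binom-sucʳ (suc a) b = m≤n+m _ _

step-mono : (f : ℕ → ℕ) → (∀ n → f n ≤ f (suc n)) → ∀ {m n} → m ≤′ n → f m ≤ f n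
step-mono f step ≤′-refl         = ≤-refl
step-mono f step (≤′-step m≤′n) = ≤-trans (step-mono f step m≤′n) (step _)

binom-mono : ∀ {a a′ b b′} → a ≤ a′ → b ≤ b′ → binom a b ≤ binom a′ b′
binom-mono {a} {a′} {b} a≤a′ b≤b′ =
  ≤-trans (step-mono (λ z → binom z b) (λ z → binom-sucˡ z b) (≤⇒≤′ a≤a′))
          (step-mono (binom a′) (binom-sucʳ a′) (≤⇒≤′ b≤b′))

multinomial′ : List ℕ → ℕ
multinomial′ []       = 1
multinomial′ (a ∷ as) = binom a (sum as) * multinomial′ as

factorials : List ℕ → ℕ
factorials ks = product (map _! ks)

multinomial′-factorial : ∀ ks → multinomial′ ks * factorials ks ≡ sum ks !
multinomial′-factorial []       = refl
multinomial′-factorial (a ∷ as) = begin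
  binom a s * multinomial′ as * (a ! * factorials as)
    ≡⟨ regroup (binom a s) (multinomial′ as) (a !) (factorials as) ⟩
  binom a s * (a ! * (multinomial′ as * factorials as))
    ≡⟨ cong (λ z → binom a s * (a ! * z)) (multinomial′-factorial as) ⟩
  binom a s * (a ! * s !)
    ≡⟨ binom-factorial a s ⟩
  (a + s) ! ∎
  where
  open ≡-Reasoning
  s = sum as
  regroup : ∀ x y z w → x * y * (z * w) ≡ x * (z * (y * w))
  regroup = solve-∀

multinomial′≡multinomial : ∀ ks → multinomial′ ks ≡ multinomial ks
multinomial′≡multinomial ks = sym (begin
  (sum ks ! / factorials ks) {{productFact≢0 ks}}
    ≡⟨ cong (λ z → (z / factorials ks) {{productFact≢0 ks}}) (multinomial′-factorial ks) ⟨
  (multinomial′ ks * factorials ks / factorials ks) {{productFact≢0 ks}}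
    ≡⟨ m*n/n≡m (multinomial′ ks) (factorials ks) {{productFact≢0 ks}} ⟩
  multinomial′ ks ∎)
  where open ≡-Reasoning

1≤multinomial′ : ∀ ks → 1 ≤ multinomial′ ks
1≤multinomial′ []       = ≤-refl
1≤multinomial′ (a ∷ as) = *-mono-≤ (1≤binom a (sum as)) (1≤multinomial′ as)

factorials≤sum! : ∀ ks → factorials ks ≤ sum ks !
factorials≤sum! ks = begin
  factorials ks                      ≤⟨ m≤n*m (factorials ks) (multinomial′ ks) {{>-nonZero (1≤multinomial′ ks)}} ⟩
  multinomial′ ks * factorials ks    ≡⟨ multinomial′-factorial ks ⟩
  sum ks !                           ∎
  where open ≤-Reasoning

sum-mono : ∀ {xs ys} → Pointwise _≤_ xs ys → sum xs ≤ sum ys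
sum-mono []              = ≤-refl
sum-mono (x≤y ∷ xs≤ys) = +-mono-≤ x≤y (sum-mono xs≤ys)

multinomial′-mono : ∀ {xs ys} → Pointwise _≤_ xs ys → multinomial′ xs ≤ multinomial′ ys
multinomial′-mono []              = ≤-refl
multinomial′-mono (x≤y ∷ xs≤ys) =
  *-mono-≤ (binom-mono x≤y (sum-mono xs≤ys)) (multinomial′-mono xs≤ys)

factorial-exchange : ∀ {x y} → x ≤ y → suc x ! * y ! ≤ x ! * suc y !
factorial-exchange {x} {y} x≤y = begin
  suc x ! * y !          ≡⟨ *-assoc (suc x) (x !) (y !) ⟩
  suc x * (x ! * y !)    ≤⟨ *-monoˡ-≤ (x ! * y !) (s≤s x≤y) ⟩
  suc y * (x ! * y !)    ≡⟨ shuffle (x !) (y !) y ⟩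
  x ! * suc y !          ∎
  where
  open ≤-Reasoning
  shuffle : ∀ X Y y → suc y * (X * Y) ≡ X * (Y + y * Y)
  shuffle = solve-∀

halfFactorials : ℕ → ℕ
halfFactorials h = ⌊ h /2⌋ ! * ⌈ h /2⌉ !

halfFactorials-double : ∀ x → halfFactorials (x + x) ≡ x ! * x !
halfFactorials-double x = sym (cong₂ (λ p q → p ! * q !) (n≡⌊n+n/2⌋ x) (n≡⌈n+n/2⌉ x))

halfFactorials-≤-gap : ∀ x d → halfFactorials (x + (x + d)) ≤ x ! * (x + d) !
halfFactorials-≤-gap x zero = ≤-reflexive (begin
  halfFactorials (x + (x + 0))   ≡⟨ cong (λ z → halfFactorials (x + z)) (+-identityʳ x) ⟩
  halfFactorials (x + x)         ≡⟨ halfFactorials-double x ⟩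
  x ! * x !                      ≡⟨ cong (λ z → x ! * z !) (+-identityʳ x) ⟨
  x ! * (x + 0) !                ∎)
  where open ≡-Reasoning
halfFactorials-≤-gap x (suc zero) = ≤-reflexive (begin
  halfFactorials (x + (x + 1))        ≡⟨ cong halfFactorials (trans (cong (x +_) (+-comm x 1)) (+-suc x x)) ⟩
  ⌊ suc (x + x) /2⌋ ! * suc ⌊ x + x /2⌋ !
    ≡⟨ cong₂ (λ p q → p ! * suc q !) (sym (n≡⌈n+n/2⌉ x)) (sym (n≡⌊n+n/2⌋ x)) ⟩
  x ! * suc x !                       ≡⟨ cong (λ z → x ! * z !) (+-comm 1 x) ⟩
  x ! * (x + 1) !                     ∎)
  where open ≡-Reasoning
halfFactorials-≤-gap x (suc (suc d)) = begin
  halfFactorials (x + (x + suc (suc d)))   ≡⟨ cong halfFactorials (recentre x d) ⟩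
  halfFactorials (suc x + (suc x + d))     ≤⟨ halfFactorials-≤-gap (suc x) d ⟩
  suc x ! * (suc x + d) !                  ≡⟨ cong (λ z → suc x ! * z !) (sym (+-suc x d)) ⟩
  suc x ! * (x + suc d) !                  ≤⟨ factorial-exchange (m≤m+n x (suc d)) ⟩
  x ! * suc (x + suc d) !                  ≡⟨ cong (λ z → x ! * z !) (sym (+-suc x (suc d))) ⟩
  x ! * (x + suc (suc d)) !                ∎
  where
  open ≤-Reasoning
  recentre : ∀ x d → x + (x + suc (suc d)) ≡ suc x + (suc x + d)
  recentre = solve-∀

halfFactorials-≤ : ∀ x y → halfFactorials (x + y) ≤ x ! * y !
halfFactorials-≤ x y with ≤-total x y
... | inj₁ x≤y = subst (λ z → halfFactorials (x + z) ≤ x ! * z !) (m+[n∸m]≡n x≤y)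
                       (halfFactorials-≤-gap x (y ∸ x))
... | inj₂ y≤x = subst₂ _≤_ (cong halfFactorials (+-comm y x)) (*-comm (y !) (x !))
                   (subst (λ z → halfFactorials (y + z) ≤ y ! * z !) (m+[n∸m]≡n y≤x)
                          (halfFactorials-≤-gap y (x ∸ y)))

data PointwiseSum : List ℕ → List ℕ → List ℕ → Set where
  []  : PointwiseSum [] [] []
  _∷_ : ∀ {x y z xs ys zs} → x + y ≡ z → PointwiseSum xs ys zs →
        PointwiseSum (x ∷ xs) (y ∷ ys) (z ∷ zs)

PointwiseSum-++ : ∀ {xs ys zs xs′ ys′ zs′} → PointwiseSum xs ys zs → PointwiseSum xs′ ys′ zs′ →
                  PointwiseSum (xs ++ xs′) (ys ++ ys′) (zs ++ zs′)
PointwiseSum-++ []         q = q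
PointwiseSum-++ (e ∷ p) q = e ∷ PointwiseSum-++ p q

PointwiseSum-halves : ∀ zs → PointwiseSum (map ⌊_/2⌋ zs) (map ⌈_/2⌉ zs) zs
PointwiseSum-halves []       = []
PointwiseSum-halves (z ∷ zs) = ⌊n/2⌋+⌈n/2⌉≡n z ∷ PointwiseSum-halves zs

PointwiseSum-sum : ∀ {xs ys zs} → PointwiseSum xs ys zs → sum xs + sum ys ≡ sum zs
PointwiseSum-sum []                               = refl
PointwiseSum-sum (_∷_ {x} {y} {xs = xs} {ys} e p) =
  trans (+-interchange x (sum xs) y (sum ys)) (cong₂ _+_ e (PointwiseSum-sum p))

PointwiseSum-factorials : ∀ {xs ys zs} → PointwiseSum xs ys zs →
  factorials (map ⌊_/2⌋ zs) * factorials (map ⌈_/2⌉ zs) ≤ factorials xs * factorials ys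
PointwiseSum-factorials []                                = ≤-refl
PointwiseSum-factorials (_∷_ {x} {y} {z} {xs} {ys} {zs} e p) =
  subst₂ _≤_ (*-interchange (⌊ z /2⌋ !) (⌈ z /2⌉ !) (factorials (map ⌊_/2⌋ zs)) (factorials (map ⌈_/2⌉ zs)))
             (*-interchange (x !) (y !) (factorials xs) (factorials ys))
    (*-mono-≤ (subst (λ w → halfFactorials w ≤ x ! * y !) e (halfFactorials-≤ x y))
              (PointwiseSum-factorials p))

-- Clearing denominators, this is  N! N! ∏ ⌊zᵢ/2⌋! ⌈zᵢ/2⌉! ≤ (Σ ⌊zᵢ/2⌋)! (Σ ⌈zᵢ/2⌉)! ∏ xᵢ! yᵢ!
-- with N = Σ xᵢ = Σ yᵢ: both factors are instances of halfFactorials-≤.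
multinomial′-split-≤-halves : ∀ {xs ys zs} → PointwiseSum xs ys zs → sum xs ≡ sum ys →
  multinomial′ xs * multinomial′ ys ≤ multinomial′ (map ⌊_/2⌋ zs) * multinomial′ (map ⌈_/2⌉ zs)
multinomial′-split-≤-halves {xs} {ys} {zs} p Σx≡Σy =
  *-cancelʳ-≤ _ _ (Fxy * Fhalves) {{m*n≢0 Fxy Fhalves {{Fxy≢0}} {{Fhalves≢0}}}}
    (begin
      multinomial′ xs * multinomial′ ys * (Fxy * Fhalves)
        ≡⟨ clear (multinomial′ xs) (multinomial′ ys) (factorials xs) (factorials ys) Fhalves ⟩
      multinomial′ xs * factorials xs * (multinomial′ ys * factorials ys) * Fhalves
        ≡⟨ cong₂ (λ a b → a * b * Fhalves) (multinomial′-factorial xs)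
                 (trans (multinomial′-factorial ys) (cong _! (sym Σx≡Σy))) ⟩
      N ! * N ! * Fhalves
        ≤⟨ *-mono-≤ N!N!≤ (PointwiseSum-factorials p) ⟩
      sum fl ! * sum ce ! * Fxy
        ≡⟨ cong₂ (λ a b → a * b * Fxy) (multinomial′-factorial fl) (multinomial′-factorial ce) ⟨
      multinomial′ fl * factorials fl * (multinomial′ ce * factorials ce) * Fxy
        ≡⟨ clear′ (multinomial′ fl) (multinomial′ ce) (factorials fl) (factorials ce) Fxy ⟩
      multinomial′ fl * multinomial′ ce * (Fxy * Fhalves) ∎)
  where
  open ≤-Reasoning
  fl = map ⌊_/2⌋ zs
  ce = map ⌈_/2⌉ zs
  N = sum xs
  Fxy = factorials xs * factorials ys
  Fhalves = factorials fl * factorials ce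
  Fxy≢0 : NonZero Fxy
  Fxy≢0 = m*n≢0 _ _ {{productFact≢0 xs}} {{productFact≢0 ys}}
  Fhalves≢0 : NonZero Fhalves
  Fhalves≢0 = m*n≢0 _ _ {{productFact≢0 fl}} {{productFact≢0 ce}}
  Σhalves : sum fl + sum ce ≡ N + N
  Σhalves = trans (PointwiseSum-sum (PointwiseSum-halves zs))
                  (trans (sym (PointwiseSum-sum p)) (cong (N +_) (sym Σx≡Σy)))
  N!N!≤ : N ! * N ! ≤ sum fl ! * sum ce !
  N!N!≤ = subst (_≤ sum fl ! * sum ce !) (trans (cong halfFactorials Σhalves) (halfFactorials-double N))
                (halfFactorials-≤ (sum fl) (sum ce))
  clear : ∀ a b c d e → a * b * (c * d * e) ≡ a * c * (b * d) * e
  clear = solve-∀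
  clear′ : ∀ a b c d e → a * c * (b * d) * e ≡ a * b * (e * (c * d))
  clear′ = solve-∀

multinomial′-balanced-split : ∀ {xs ys zs} → PointwiseSum xs ys zs → sum xs ≡ sum ys →
  multinomial′ xs * multinomial′ ys ≤ multinomial′ (map ⌈_/2⌉ zs) * multinomial′ (map ⌈_/2⌉ zs)
multinomial′-balanced-split {zs = zs} p Σx≡Σy =
  ≤-trans (multinomial′-split-≤-halves p Σx≡Σy)
          (*-monoˡ-≤ (multinomial′ (map ⌈_/2⌉ zs))
            (multinomial′-mono (map⁺ ⌊_/2⌋ ⌈_/2⌉ (PW.refl (λ {z} → ⌊n/2⌋≤⌈n/2⌉ z) {zs}))))

sum-concatMap : ∀ {A : Set} (F : A → List ℕ) xs → sum (concatMap F xs) ≡ sum (map (sum ∘ F) xs)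
sum-concatMap F []       = refl
sum-concatMap F (x ∷ xs) = trans (sum-++ (F x) (concatMap F xs)) (cong (sum (F x) +_) (sum-concatMap F xs))

private
  factorials-concatMap : ∀ {A : Set} (F : A → List ℕ) xs → factorials (concatMap F xs) ≤ factorials (map (sum ∘ F) xs)
  factorials-concatMap F []       = ≤-refl
  factorials-concatMap F (x ∷ xs) = begin
    factorials (F x ++ concatMap F xs)                 ≡⟨ cong product (map-++ _! (F x) (concatMap F xs)) ⟩
    product (map _! (F x) ++ map _! (concatMap F xs))  ≡⟨ product-++ (map _! (F x)) _ ⟩
    factorials (F x) * factorials (concatMap F xs)     ≤⟨ *-mono-≤ (factorials≤sum! (F x)) (factorials-concatMap F xs) ⟩
    sum (F x) ! * factorials (map (sum ∘ F) xs)        ∎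
    where open ≤-Reasoning

multinomial′-merge : ∀ {A : Set} (F : A → List ℕ) xs →
                     multinomial′ (map (sum ∘ F) xs) ≤ multinomial′ (concatMap F xs)
multinomial′-merge F xs =
  *-cancelʳ-≤ _ _ (Fmerged * Fsplit) {{m*n≢0 _ _ {{productFact≢0 merged}} {{productFact≢0 split}}}} (begin
  multinomial′ merged * (Fmerged * Fsplit)       ≡⟨ *-assoc (multinomial′ merged) Fmerged Fsplit ⟨
  multinomial′ merged * Fmerged * Fsplit         ≡⟨ cong (_* Fsplit) (multinomial′-factorial merged) ⟩
  sum merged ! * Fsplit                          ≤⟨ *-monoʳ-≤ (sum merged !) (factorials-concatMap F xs) ⟩
  sum merged ! * Fmerged                         ≡⟨ cong (λ s → s ! * Fmerged) (sum-concatMap F xs) ⟨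
  sum split ! * Fmerged                          ≡⟨ cong (_* Fmerged) (multinomial′-factorial split) ⟨
  multinomial′ split * Fsplit * Fmerged          ≡⟨ *-assoc (multinomial′ split) Fsplit Fmerged ⟩
  multinomial′ split * (Fsplit * Fmerged)        ≡⟨ cong (multinomial′ split *_) (*-comm Fsplit Fmerged) ⟩
  multinomial′ split * (Fmerged * Fsplit)        ∎)
  where
  open ≤-Reasoning
  merged = map (sum ∘ F) xs
  split  = concatMap F xs
  Fmerged = factorials merged
  Fsplit  = factorials split

module _ {c ℓ} (M : CommutativeMonoid c ℓ) where
  open CommutativeMonoid M using (Carrier; _≈_; _∙_; ∙-congˡ; ∙-congʳ)
  private module M = CommutativeMonoid M
  open import Algebra.Properties.CommutativeMonoid.Sum M using (sum-remove; sum-cong-≋)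
    renaming (sum to fold)
  open import Algebra.Solver.CommutativeMonoid M using (solve; _⊕_; _⊜_)
  open import Relation.Binary.Reasoning.Setoid M.setoid

  fold-exchange : ∀ {n} (f g : Fin n → Carrier) e → (∀ i → ¬ i ≡ e → f i ≈ g i) →
                  fold f ∙ g e ≈ fold g ∙ f e
  fold-exchange {suc n} f g e f≈g = begin
    fold f ∙ g e                           ≈⟨ ∙-congʳ (sum-remove f) ⟩
    (f e ∙ fold (removeAt f e)) ∙ g e      ≈⟨ ∙-congʳ (∙-congˡ (sum-cong-≋ λ i → f≈g _ (punchInᵢ≢i e i))) ⟩
    (f e ∙ fold (removeAt g e)) ∙ g e      ≈⟨ solve 3 (λ a r b → (a ⊕ r) ⊕ b ⊜ (b ⊕ r) ⊕ a) M.refl (f e) _ (g e) ⟩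
    (g e ∙ fold (removeAt g e)) ∙ f e      ≈⟨ ∙-congʳ (M.sym (sum-remove g)) ⟩
    fold g ∙ f e                           ∎

∑-exchange : ∀ {n} (f g : Fin n → ℕ) e → (∀ i → ¬ i ≡ e → f i ≡ g i) → ∑ f + g e ≡ ∑ g + f e
∑-exchange = fold-exchange +-0-commutativeMonoid

∏-exchange : ∀ {n} (f g : Fin n → ℕ) e → (∀ i → ¬ i ≡ e → f i ≡ g i) → ∏ f * g e ≡ ∏ g * f e
∏-exchange = fold-exchange *-1-commutativeMonoid

∑-supported : ∀ {n} (f : Fin n → ℕ) e → (∀ i → ¬ i ≡ e → f i ≡ 0) → ∑ f ≡ f e
∑-supported {n} f e f≡0 = begin
  ∑ f                    ≡⟨ +-identityʳ (∑ f) ⟨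
  ∑ f + 0                ≡⟨ ∑-exchange f (λ _ → 0) e f≡0 ⟩
  ∑ {n} (λ _ → 0) + f e  ≡⟨ cong (_+ f e) (sum-replicate-zero n) ⟩
  f e                    ∎
  where open ≡-Reasoning

∑-mono : ∀ {n} {f g : Fin n → ℕ} → (∀ i → f i ≤ g i) → ∑ f ≤ ∑ g
∑-mono {zero}  f≤g = ≤-refl
∑-mono {suc n} f≤g = +-mono-≤ (f≤g zero) (∑-mono (f≤g ∘ suc))

∏-mono : ∀ {n} {f g : Fin n → ℕ} → (∀ i → f i ≤ g i) → ∏ f ≤ ∏ g
∏-mono {zero}  f≤g = ≤-refl
∏-mono {suc n} f≤g = *-mono-≤ (f≤g zero) (∏-mono (f≤g ∘ suc))

≤-∑ : ∀ {n} (f : Fin n → ℕ) i → f i ≤ ∑ f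
≤-∑ {suc n} f i = ≤-trans (m≤m+n (f i) _) (≤-reflexive (sym (∑-remove f)))

∏-≤-^ : ∀ {n} {f : Fin n → ℕ} {B} → (∀ i → f i ≤ B) → ∏ f ≤ B ^ n
∏-≤-^ {zero}  f≤B = ≤-refl
∏-≤-^ {suc n} f≤B = *-mono-≤ (f≤B zero) (∏-≤-^ (f≤B ∘ suc))

1≤∏ : ∀ {n} {f : Fin n → ℕ} → (∀ i → 1 ≤ f i) → 1 ≤ ∏ f
1≤∏ {zero}  1≤f = ≤-refl
1≤∏ {suc n} 1≤f = *-mono-≤ (1≤f zero) (1≤∏ (1≤f ∘ suc))

∑-tabulate : ∀ {n} (f : Fin n → ℕ) → sum (tabulate f) ≡ ∑ f
∑-tabulate {zero}  f = refl
∑-tabulate {suc n} f = cong (f zero +_) (∑-tabulate (f ∘ suc))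

∏-tabulate : ∀ {n} (f : Fin n → ℕ) → product (tabulate f) ≡ ∏ f
∏-tabulate {zero}  f = refl
∏-tabulate {suc n} f = cong (f zero *_) (∏-tabulate (f ∘ suc))

multinomialᶠ : ∀ {n} → (Fin n → ℕ) → ℕ
multinomialᶠ o = multinomial′ (tabulate o)

multinomialᶠ-cong : ∀ {n} {o o′ : Fin n → ℕ} → (∀ i → o i ≡ o′ i) → multinomialᶠ o ≡ multinomialᶠ o′
multinomialᶠ-cong o≗o′ = cong multinomial′ (tabulate-cong o≗o′)

1≤multinomialᶠ : ∀ {n} (o : Fin n → ℕ) → 1 ≤ multinomialᶠ o
1≤multinomialᶠ o = 1≤multinomial′ (tabulate o)

multinomialᶠ-factorial : ∀ {n} (o : Fin n → ℕ) → multinomialᶠ o * ∏ (λ i → o i !) ≡ ∑ o !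
multinomialᶠ-factorial o = begin
  multinomialᶠ o * ∏ (λ i → o i !)          ≡⟨ cong (multinomialᶠ o *_) (∏-tabulate (λ i → o i !)) ⟨
  multinomialᶠ o * product (tabulate (λ i → o i !))
    ≡⟨ cong (λ l → multinomialᶠ o * product l) (map-tabulate o _!) ⟨
  multinomialᶠ o * factorials (tabulate o)  ≡⟨ multinomial′-factorial (tabulate o) ⟩
  sum (tabulate o) !                        ≡⟨ cong _! (∑-tabulate o) ⟩
  ∑ o !                                     ∎
  where open ≡-Reasoning

∏-factorials≢0 : ∀ {n} (o : Fin n → ℕ) → NonZero (∏ (λ i → o i !))
∏-factorials≢0 o = >-nonZero (1≤∏ (λ i → 1≤n! (o i)))

module _ {n} (o : Fin n → ℕ) (e : Fin n) {k} (oₑ≡1+k : o e ≡ suc k) where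
  private
    d = updateAt o e pred
    dₑ≡k : d e ≡ k
    dₑ≡k = trans (updateAt-updates e o) (cong pred oₑ≡1+k)
    agree : ∀ {f : ℕ → ℕ} i → ¬ i ≡ e → f (o i) ≡ f (d i)
    agree {f} i i≢e = cong f (sym (updateAt-minimal i e o i≢e))

  ∑-decrement : ∑ o ≡ suc (∑ d)
  ∑-decrement = +-cancelʳ-≡ k _ _ (begin
    ∑ o + k           ≡⟨ cong (∑ o +_) dₑ≡k ⟨
    ∑ o + d e         ≡⟨ ∑-exchange o d e (agree {λ z → z}) ⟩
    ∑ d + o e         ≡⟨ cong (∑ d +_) oₑ≡1+k ⟩
    ∑ d + suc k       ≡⟨ +-suc (∑ d) k ⟩
    suc (∑ d) + k     ∎)
    where open ≡-Reasoning

  ∏-factorials-decrement : ∏ (λ i → o i !) ≡ ∏ (λ i → d i !) * suc k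
  ∏-factorials-decrement = *-cancelʳ-≡ _ _ (k !) {{k !≢0}} (begin
    ∏ (λ i → o i !) * k !             ≡⟨ cong (λ z → ∏ (λ i → o i !) * z !) dₑ≡k ⟨
    ∏ (λ i → o i !) * d e !           ≡⟨ ∏-exchange (λ i → o i !) (λ i → d i !) e (agree {_!}) ⟩
    ∏ (λ i → d i !) * o e !           ≡⟨ cong (λ z → ∏ (λ i → d i !) * z !) oₑ≡1+k ⟩
    ∏ (λ i → d i !) * suc k !         ≡⟨ *-assoc (∏ (λ i → d i !)) (suc k) (k !) ⟨
    ∏ (λ i → d i !) * suc k * k !     ∎)
    where open ≡-Reasoning

pascalTerm : ∀ {n} → (Fin n → ℕ) → Fin n → ℕ
pascalTerm o e with o e
... | zero  = 0
... | suc _ = multinomialᶠ (updateAt o e pred)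

pascalTerm-factorial : ∀ {n} (o : Fin n → ℕ) e → pascalTerm o e * ∏ (λ i → o i !) ≡ (∑ o ∸ 1) ! * o e
pascalTerm-factorial o e with o e in oₑ≡
... | zero  = sym (*-zeroʳ ((∑ o ∸ 1) !))
... | suc k = begin
  multinomialᶠ d * ∏ (λ i → o i !)                 ≡⟨ cong (multinomialᶠ d *_) (∏-factorials-decrement o e oₑ≡) ⟩
  multinomialᶠ d * (∏ (λ i → d i !) * suc k)       ≡⟨ *-assoc (multinomialᶠ d) _ (suc k) ⟨
  multinomialᶠ d * ∏ (λ i → d i !) * suc k         ≡⟨ cong (_* suc k) (multinomialᶠ-factorial d) ⟩
  ∑ d ! * suc k                                    ≡⟨ cong (λ z → pred z ! * suc k) (∑-decrement o e oₑ≡) ⟨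
  (∑ o ∸ 1) ! * suc k                              ∎
  where
  open ≡-Reasoning
  d = updateAt o e pred

-- Summing pascalTerm-factorial over e gives (∑ o ∸ 1)! ∑ o = (∑ o)!, i.e. the multinomial recurrence.
multinomialᶠ-pascal : ∀ {n} (o : Fin n → ℕ) → ∑ (pascalTerm o) ≤ multinomialᶠ o
multinomialᶠ-pascal o = *-cancelʳ-≤ _ _ P {{∏-factorials≢0 o}} (begin
  ∑ (pascalTerm o) * P                   ≡⟨ *-distribʳ-sum P (pascalTerm o) ⟩
  ∑ (λ e → pascalTerm o e * P)           ≡⟨ ∑-cong (pascalTerm-factorial o) ⟩
  ∑ (λ e → (∑ o ∸ 1) ! * o e)            ≡⟨ *-distribˡ-sum ((∑ o ∸ 1) !) o ⟨
  (∑ o ∸ 1) ! * ∑ o                      ≤⟨ pred!*≤! (∑ o) ⟩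
  ∑ o !                                  ≡⟨ multinomialᶠ-factorial o ⟨
  multinomialᶠ o * P                     ∎)
  where
  open ≤-Reasoning
  P = ∏ (λ i → o i !)
  pred!*≤! : ∀ s → (s ∸ 1) ! * s ≤ s !
  pred!*≤! zero    = z≤n
  pred!*≤! (suc s) = ≤-reflexive (*-comm (s !) (suc s))

pascalTerm-pos : ∀ {n} (o : Fin n → ℕ) e → 1 ≤ o e → pascalTerm o e ≡ multinomialᶠ (updateAt o e pred)
pascalTerm-pos o e 1≤oₑ with o e | 1≤oₑ
... | suc _ | _ = refl

record Decrement {n m} (o o′ : Fin n → Fin m → ℕ) (a : Fin n) (f : Fin m) : Set where
  field
    elsewhere : ∀ w → ¬ w ≡ a → ∀ e → o′ w e ≡ o w e
    at        : ∀ e → o′ a e ≡ updateAt (o a) f pred e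
    positive  : 1 ≤ o a f

∏multinomialᶠ-decrement : ∀ {n m} {o o′ : Fin n → Fin m → ℕ} {a f} → Decrement o o′ a f →
  multinomialᶠ (o a) * ∏ (λ w → multinomialᶠ (o′ w)) ≡ ∏ (λ w → multinomialᶠ (o w)) * pascalTerm (o a) f
∏multinomialᶠ-decrement {o = o} {o′} {a} {f} d = begin
  multinomialᶠ (o a) * ∏ M′                    ≡⟨ *-comm (multinomialᶠ (o a)) (∏ M′) ⟩
  ∏ M′ * M a                                   ≡⟨ ∏-exchange M M′ a (λ w w≢a → sym (multinomialᶠ-cong (elsewhere w w≢a))) ⟨
  ∏ M * M′ a                                   ≡⟨ cong (∏ M *_) (multinomialᶠ-cong at) ⟩
  ∏ M * multinomialᶠ (updateAt (o a) f pred)   ≡⟨ cong (∏ M *_) (pascalTerm-pos (o a) f positive) ⟨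
  ∏ M * pascalTerm (o a) f                     ∎
  where
  open ≡-Reasoning
  open Decrement d
  M M′ : _ → ℕ
  M w = multinomialᶠ (o w)
  M′ w = multinomialᶠ (o′ w)

χ : Bool → ℕ
χ true  = 1
χ false = 0

χ-∧ : ∀ a b → χ (a ∧ b) ≡ χ a * χ b
χ-∧ true  b = sym (+-identityʳ (χ b))
χ-∧ false b = refl

χ≤1 : ∀ a → χ a ≤ 1
χ≤1 true  = ≤-refl
χ≤1 false = z≤n

χ-true : ∀ {a} → T a → χ a ≡ 1
χ-true {true} _ = refl

χ-false : ∀ {a} → ¬ T a → χ a ≡ 0
χ-false {true}  ¬a = ⊥-elim (¬a tt)
χ-false {false} _  = refl

χ-mono : ∀ {a b} → (T a → T b) → χ a ≤ χ b
χ-mono {false}         _   = z≤n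
χ-mono {true}  {true}  _   = ≤-refl
χ-mono {true}  {false} a⇒b = ⊥-elim (a⇒b tt)

χ≤ : ∀ {a K} → (T a → 1 ≤ K) → χ a ≤ K
χ≤ {true}  h = h tt
χ≤ {false} h = z≤n

χ*-mono : ∀ a {K L} → (T a → K ≤ L) → χ a * K ≤ χ a * L
χ*-mono true  K≤L = *-monoʳ-≤ 1 (K≤L tt)
χ*-mono false _   = z≤n

∑ᴸ : ∀ {A : Set} → List A → (A → ℕ) → ℕ
∑ᴸ xs f = sum (map f xs)

syntax ∑ᴸ xs (λ x → e) = ∑[ x ∈ xs ] e

∑ᴸ-cong : ∀ {A : Set} (xs : List A) {f g : A → ℕ} → (∀ a → f a ≡ g a) → ∑ᴸ xs f ≡ ∑ᴸ xs g
∑ᴸ-cong []       f≗g = refl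
∑ᴸ-cong (x ∷ xs) f≗g = cong₂ _+_ (f≗g x) (∑ᴸ-cong xs f≗g)

∑ᴸ-mono : ∀ {A : Set} (xs : List A) {f g : A → ℕ} → (∀ a → f a ≤ g a) → ∑ᴸ xs f ≤ ∑ᴸ xs g
∑ᴸ-mono []       f≤g = ≤-refl
∑ᴸ-mono (x ∷ xs) f≤g = +-mono-≤ (f≤g x) (∑ᴸ-mono xs f≤g)

∑ᴸ-++ : ∀ {A : Set} (xs ys : List A) f → ∑ᴸ (xs ++ ys) f ≡ ∑ᴸ xs f + ∑ᴸ ys f
∑ᴸ-++ []       ys f = refl
∑ᴸ-++ (x ∷ xs) ys f = trans (cong (f x +_) (∑ᴸ-++ xs ys f)) (sym (+-assoc (f x) _ _))

∑ᴸ-map : ∀ {A B : Set} (xs : List A) (g : A → B) f → ∑ᴸ (map g xs) f ≡ ∑ᴸ xs (f ∘ g)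
∑ᴸ-map []       g f = refl
∑ᴸ-map (x ∷ xs) g f = cong (f (g x) +_) (∑ᴸ-map xs g f)

∑ᴸ-concatMap : ∀ {A B : Set} (xs : List A) (F : A → List B) f →
               ∑ᴸ (concatMap F xs) f ≡ ∑[ a ∈ xs ] ∑ᴸ (F a) f
∑ᴸ-concatMap []       F f = refl
∑ᴸ-concatMap (x ∷ xs) F f =
  trans (∑ᴸ-++ (F x) (concatMap F xs) f) (cong (∑ᴸ (F x) f +_) (∑ᴸ-concatMap xs F f))

∑ᴸ-*ˡ : ∀ {A : Set} (xs : List A) c f → c * ∑ᴸ xs f ≡ ∑[ a ∈ xs ] (c * f a)
∑ᴸ-*ˡ []       c f = *-zeroʳ c
∑ᴸ-*ˡ (x ∷ xs) c f = trans (*-distribˡ-+ c (f x) _) (cong (c * f x +_) (∑ᴸ-*ˡ xs c f))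

∑ᴸ-+ : ∀ {A : Set} (xs : List A) f g → ∑[ a ∈ xs ] (f a + g a) ≡ ∑ᴸ xs f + ∑ᴸ xs g
∑ᴸ-+ []       f g = refl
∑ᴸ-+ (x ∷ xs) f g = trans (cong (f x + g x +_) (∑ᴸ-+ xs f g)) (+-interchange (f x) (g x) _ _)

∑ᴸ-zero : ∀ {A : Set} (xs : List A) → ∑[ a ∈ xs ] 0 ≡ 0
∑ᴸ-zero []       = refl
∑ᴸ-zero (x ∷ xs) = ∑ᴸ-zero xs

∑ᴸ-comm : ∀ {A B : Set} (xs : List A) (ys : List B) (F : A → B → ℕ) →
          ∑[ a ∈ xs ] ∑[ b ∈ ys ] F a b ≡ ∑[ b ∈ ys ] ∑[ a ∈ xs ] F a b
∑ᴸ-comm []       ys F = sym (∑ᴸ-zero ys)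
∑ᴸ-comm (x ∷ xs) ys F =
  trans (cong (∑ᴸ ys (F x) +_) (∑ᴸ-comm xs ys F)) (sym (∑ᴸ-+ ys (F x) (λ b → ∑[ a ∈ xs ] F a b)))

∑ᴸ-allFin : ∀ {n} (f : Fin n → ℕ) → ∑ᴸ (allFin n) f ≡ ∑ f
∑ᴸ-allFin f = trans (cong sum (map-tabulate (λ i → i) f)) (∑-tabulate f)

length-filter : ∀ {A : Set} (p : A → Bool) xs → length (filter (T? ∘ p) xs) ≡ ∑[ x ∈ xs ] χ (p x)
length-filter p []       = refl
length-filter p (x ∷ xs) with p x
... | true  = cong suc (length-filter p xs)
... | false = length-filter p xs

allLists-∷ : ∀ {A : Set} (S : List A) l g →
  ∑ᴸ (allLists S (suc l)) g ≡ ∑[ s ∈ S ] ∑[ t ∈ allLists S l ] g (s ∷ t)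
allLists-∷ S l g = trans (∑ᴸ-concatMap S _ g) (∑ᴸ-cong S (λ s → ∑ᴸ-map (allLists S l) (s ∷_) g))

allLists-∷ʳ : ∀ {A : Set} (S : List A) l g →
  ∑ᴸ (allLists S (suc l)) g ≡ ∑[ t ∈ allLists S l ] ∑[ s ∈ S ] g (t ++ [ s ])
allLists-∷ʳ S zero    g = begin
  ∑ᴸ (allLists S 1) g              ≡⟨ allLists-∷ S zero g ⟩
  ∑[ s ∈ S ] (g [ s ] + 0)         ≡⟨ ∑ᴸ-cong S (λ s → +-identityʳ (g [ s ])) ⟩
  ∑[ s ∈ S ] g [ s ]               ≡⟨ +-identityʳ _ ⟨
  ∑[ s ∈ S ] g [ s ] + 0           ∎
  where open ≡-Reasoning
allLists-∷ʳ S (suc l) g = begin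
  ∑ᴸ (allLists S (suc (suc l))) g
    ≡⟨ allLists-∷ S (suc l) g ⟩
  ∑[ s ∈ S ] ∑[ t ∈ allLists S (suc l) ] g (s ∷ t)
    ≡⟨ ∑ᴸ-cong S (λ s → allLists-∷ʳ S l (λ t → g (s ∷ t))) ⟩
  ∑[ s ∈ S ] ∑[ t ∈ allLists S l ] ∑[ s′ ∈ S ] g (s ∷ t ++ [ s′ ])
    ≡⟨ allLists-∷ S l (λ t → ∑[ s′ ∈ S ] g (t ++ [ s′ ])) ⟨
  ∑[ t ∈ allLists S (suc l) ] ∑[ s′ ∈ S ] g (t ++ [ s′ ]) ∎
  where open ≡-Reasoning

∧-intro : ∀ {a b} → T a → T b → T (a ∧ b)
∧-intro {true} _ b = b

∧-elim : ∀ {a b} → T (a ∧ b) → T a × T b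
∧-elim {true} b = tt , b

¬T⇒T-not : ∀ {b} → ¬ T b → T (not b)
¬T⇒T-not {true}  ¬b = ¬b tt
¬T⇒T-not {false} _  = tt

T⇒¬T-not : ∀ {b} → T b → ¬ T (not b)
T⇒¬T-not {true} _ ()

allEq-sound : ∀ {m} (f g : Fin m → ℕ) → T (allEq f g) → ∀ i → f i ≡ g i
allEq-sound {m} f g f≐g i = go (allFin m) f≐g (∈-allFin i)
  where
  go : ∀ is → T (foldr (λ i r → ⌊ f i ≟ℕ g i ⌋ ∧ r) true is) → i ∈ is → f i ≡ g i
  go (j ∷ is) h i∈ with f j ≟ℕ g j
  go (j ∷ is) h (here refl) | yes fj≡gj = fj≡gj
  go (j ∷ is) h (there i∈)  | yes _     = go is h i∈

allEq-complete : ∀ {m} (f g : Fin m → ℕ) → (∀ i → f i ≡ g i) → T (allEq f g)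
allEq-complete {m} f g f≗g = go (allFin m)
  where
  go : ∀ is → T (foldr (λ i r → ⌊ f i ≟ℕ g i ⌋ ∧ r) true is)
  go []       = tt
  go (j ∷ is) with f j ≟ℕ g j
  ... | yes _    = go is
  ... | no fj≢gj = fj≢gj (f≗g j)

∑ᴸ-const : ∀ {A : Set} (xs : List A) d → ∑[ x ∈ xs ] d ≡ length xs * d
∑ᴸ-const []       d = refl
∑ᴸ-const (x ∷ xs) d = cong (d +_) (∑ᴸ-const xs d)

∈⇒≤∑ᴸ : ∀ {A : Set} {xs : List A} {x} f → x ∈ xs → f x ≤ ∑ᴸ xs f
∈⇒≤∑ᴸ f (here refl) = m≤m+n _ _
∈⇒≤∑ᴸ f (there x∈) = ≤-trans (∈⇒≤∑ᴸ f x∈) (m≤n+m _ _)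

∑ᴸ-mono-∈ : ∀ {A : Set} (xs : List A) {f g : A → ℕ} → (∀ a → a ∈ xs → f a ≤ g a) → ∑ᴸ xs f ≤ ∑ᴸ xs g
∑ᴸ-mono-∈ []       f≤g = ≤-refl
∑ᴸ-mono-∈ (x ∷ xs) f≤g = +-mono-≤ (f≤g x (here refl)) (∑ᴸ-mono-∈ xs (λ a a∈ → f≤g a (there a∈)))

=ᵇ-refl : ∀ {k} (a : Fin k) → (a =ᵇ a) ≡ true
=ᵇ-refl a with a ≟ a
... | yes _   = refl
... | no a≢a = ⊥-elim (a≢a refl)

=ᵇ-≢ : ∀ {k} {a b : Fin k} → ¬ a ≡ b → (a =ᵇ b) ≡ false
=ᵇ-≢ {a = a} {b} a≢b with a ≟ b
... | yes a≡b = ⊥-elim (a≢b a≡b)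
... | no _    = refl

χ-=ᵇ-≢ : ∀ {k} {a b : Fin k} → ¬ a ≡ b → χ (a =ᵇ b) ≡ 0
χ-=ᵇ-≢ a≢b = χ-false (a≢b ∘ toWitness)

∑-χ-unique : ∀ {n} (J : Fin n → Bool) g → (∀ v → T (J v) → v ≡ g) → ∀ K → ∑ (λ v → χ (J v) * K) ≤ K
∑-χ-unique J g unique K = begin
  ∑ (λ v → χ (J v) * K)   ≡⟨ ∑-supported _ g (λ v v≢g → cong (_* K) (χ-false (v≢g ∘ unique v))) ⟩
  χ (J g) * K             ≤⟨ *-monoˡ-≤ K (χ≤1 (J g)) ⟩
  1 * K                   ≡⟨ *-identityˡ K ⟩
  K                       ∎
  where open ≤-Reasoning

bound-by-pascal : ∀ {n m} (o : Fin m → ℕ) (J : Fin m → Fin n → Bool) (g : Fin m → Fin n) →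
  (∀ f v → T (J f v) → v ≡ g f) → ∀ {A C} (R : Fin m → Fin n → ℕ) →
  C ≤ ∑ (λ f → ∑ (λ v → χ (J f v) * R f v)) →
  (∀ f v → T (J f v) → multinomialᶠ o * R f v ≤ A * pascalTerm o f) → C ≤ A
bound-by-pascal o J g unique {A} {C} R C≤ step =
  *-cancelˡ-≤ (multinomialᶠ o) {{>-nonZero (1≤multinomialᶠ o)}} (begin
    multinomialᶠ o * C
      ≤⟨ *-monoʳ-≤ (multinomialᶠ o) C≤ ⟩
    multinomialᶠ o * ∑ (λ f → ∑ (λ v → χ (J f v) * R f v))
      ≡⟨ *-distribˡ-sum (multinomialᶠ o) (λ f → ∑ (λ v → χ (J f v) * R f v)) ⟩
    ∑ (λ f → multinomialᶠ o * ∑ (λ v → χ (J f v) * R f v))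
      ≡⟨ ∑-cong (λ f → *-distribˡ-sum (multinomialᶠ o) (λ v → χ (J f v) * R f v)) ⟩
    ∑ (λ f → ∑ (λ v → multinomialᶠ o * (χ (J f v) * R f v)))
      ≤⟨ ∑-mono (λ f → ∑-mono (λ v → pointwise f v)) ⟩
    ∑ (λ f → ∑ (λ v → χ (J f v) * (A * pascalTerm o f)))
      ≤⟨ ∑-mono (λ f → ∑-χ-unique (J f) (g f) (unique f) (A * pascalTerm o f)) ⟩
    ∑ (λ f → A * pascalTerm o f)
      ≡⟨ *-distribˡ-sum A (pascalTerm o) ⟨
    A * ∑ (pascalTerm o)
      ≤⟨ *-monoʳ-≤ A (multinomialᶠ-pascal o) ⟩
    A * multinomialᶠ o
      ≡⟨ *-comm A (multinomialᶠ o) ⟩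
    multinomialᶠ o * A ∎)
  where
  open ≤-Reasoning
  pointwise : ∀ f v → multinomialᶠ o * (χ (J f v) * R f v) ≤ χ (J f v) * (A * pascalTerm o f)
  pointwise f v = begin
    multinomialᶠ o * (χ (J f v) * R f v)   ≡⟨ *-comm-middle (multinomialᶠ o) (χ (J f v)) (R f v) ⟩
    χ (J f v) * (multinomialᶠ o * R f v)   ≤⟨ χ*-mono (J f v) (step f v) ⟩
    χ (J f v) * (A * pascalTerm o f)       ∎
    where
    *-comm-middle : ∀ a b c → a * (b * c) ≡ b * (a * c)
    *-comm-middle = solve-∀

box : ∀ {k} → (Fin k → ℕ) → List (Fin k → ℕ)
box {zero}  h = (λ ()) ∷ []
box {suc k} h = concatMap (λ c → map (c ∷ᵛ_) (box (h ∘ suc))) (upTo (suc (h zero)))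

∑-box : ∀ {k} (h : Fin (suc k) → ℕ) g →
  ∑ᴸ (box h) g ≡ ∑[ c ∈ upTo (suc (h zero)) ] ∑[ x ∈ box (h ∘ suc) ] g (c ∷ᵛ x)
∑-box h g = trans (∑ᴸ-concatMap (upTo (suc (h zero))) (λ c → map (c ∷ᵛ_) (box (h ∘ suc))) g)
                  (∑ᴸ-cong (upTo (suc (h zero))) (λ c → ∑ᴸ-map (box (h ∘ suc)) (c ∷ᵛ_) g))

∑-box-const : ∀ {k} (h : Fin k → ℕ) d → ∑[ x ∈ box h ] d ≡ ∏ (λ e → suc (h e)) * d
∑-box-const {zero}  h d = refl
∑-box-const {suc k} h d = begin
  ∑[ x ∈ box h ] d                              ≡⟨ ∑-box h (λ _ → d) ⟩
  ∑[ c ∈ range ] ∑[ x ∈ box (h ∘ suc) ] d       ≡⟨ ∑ᴸ-cong range (λ _ → ∑-box-const (h ∘ suc) d) ⟩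
  ∑[ c ∈ range ] (P * d)                        ≡⟨ ∑ᴸ-const range (P * d) ⟩
  length range * (P * d)                        ≡⟨ cong (_* (P * d)) (length-upTo (suc (h zero))) ⟩
  suc (h zero) * (P * d)                        ≡⟨ *-assoc (suc (h zero)) P d ⟨
  ∏ (λ e → suc (h e)) * d                       ∎
  where
  open ≡-Reasoning
  range = upTo (suc (h zero))
  P = ∏ (λ e → suc (h (suc e)))

box-hit : ∀ {k} (h x : Fin k → ℕ) → (∀ e → x e ≤ h e) → ∀ {K} (g : (Fin k → ℕ) → ℕ) →
  (∀ x′ → (∀ e → x′ e ≡ x e) → K ≤ g x′) → K ≤ ∑ᴸ (box h) g
box-hit {zero}  h x x≤h g K≤g = ≤-trans (K≤g _ (λ ())) (m≤m+n _ 0)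
box-hit {suc k} h x x≤h {K} g K≤g = begin
  K
    ≤⟨ box-hit (h ∘ suc) (x ∘ suc) (x≤h ∘ suc) (g ∘ (x zero ∷ᵛ_))
               (λ x′ x′≗ → K≤g (x zero ∷ᵛ x′) λ { zero → refl ; (suc e) → x′≗ e }) ⟩
  ∑[ x′ ∈ box (h ∘ suc) ] g (x zero ∷ᵛ x′)
    ≤⟨ ∈⇒≤∑ᴸ (λ c → ∑[ x′ ∈ box (h ∘ suc) ] g (c ∷ᵛ x′)) (∈-upTo⁺ (s≤s (x≤h zero))) ⟩
  ∑[ c ∈ upTo (suc (h zero)) ] ∑[ x′ ∈ box (h ∘ suc) ] g (c ∷ᵛ x′)
    ≡⟨ ∑-box h g ⟨
  ∑ᴸ (box h) g ∎
  where open ≤-Reasoning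

∑-box-mono : ∀ {k} (h : Fin k → ℕ) {g g′ : (Fin k → ℕ) → ℕ} →
  (∀ x → (∀ e → x e ≤ h e) → g x ≤ g′ x) → ∑ᴸ (box h) g ≤ ∑ᴸ (box h) g′
∑-box-mono {zero}  h g≤g′ = +-monoˡ-≤ 0 (g≤g′ _ (λ ()))
∑-box-mono {suc k} h {g} {g′} g≤g′ = begin
  ∑ᴸ (box h) g
    ≡⟨ ∑-box h g ⟩
  ∑[ c ∈ upTo (suc (h zero)) ] ∑[ x ∈ box (h ∘ suc) ] g (c ∷ᵛ x)
    ≤⟨ ∑ᴸ-mono-∈ (upTo (suc (h zero))) (λ c c∈ → ∑-box-mono (h ∘ suc) (λ x x≤ →
         g≤g′ (c ∷ᵛ x) λ { zero → ≤-pred (∈-upTo⁻ c∈) ; (suc e) → x≤ e })) ⟩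
  ∑[ c ∈ upTo (suc (h zero)) ] ∑[ x ∈ box (h ∘ suc) ] g′ (c ∷ᵛ x)
    ≡⟨ ∑-box h g′ ⟨
  ∑ᴸ (box h) g′ ∎
  where open ≤-Reasoning

-- Walks and their profiles

record Profile (m : ℕ) : Set where
  constructor ⟨_,_⟩
  field
    forwards backwards : Fin m → ℕ
open Profile public

module Walks {n m : ℕ} (G : Graph n m) where

  end₁ end₂ : Fin m → Fin n
  end₁ e = proj₁ (ends G e)
  end₂ e = proj₂ (ends G e)

  joins-spec : ∀ {f a v} → T (joins G f a v) → (end₁ f ≡ a × end₂ f ≡ v) ⊎ (end₁ f ≡ v × end₂ f ≡ a)
  joins-spec {f} {a} {v} j with ends G f
  ... | (x , y) with x ≟ a | y ≟ v | x ≟ v | y ≟ a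
  ...   | yes p | yes q | _     | _     = inj₁ (p , q)
  ...   | _     | _     | yes p | yes q = inj₂ (p , q)
  ...   | no _  | _     | no _  | _     = ⊥-elim j
  ...   | no _  | _     | yes _ | no _  = ⊥-elim j
  ...   | yes _ | no _  | no _  | _     = ⊥-elim j
  ...   | yes _ | no _  | yes _ | no _  = ⊥-elim j

  opposite : Fin m → Fin n → Fin n
  opposite f a = if end₁ f =ᵇ a then end₂ f else end₁ f

  private
    opposite-spec : ∀ {f a v} → (end₁ f ≡ a × end₂ f ≡ v) ⊎ (end₁ f ≡ v × end₂ f ≡ a) → v ≡ opposite f a
    opposite-spec {f} {a} {v} spec with end₁ f ≟ a | spec
    ... | yes _   | inj₁ (_ , e₂≡v)         = sym e₂≡v
    ... | yes e₁≡a | inj₂ (e₁≡v , e₂≡a)     = trans (sym e₁≡v) (trans e₁≡a (sym e₂≡a))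
    ... | no e₁≢a | inj₁ (e₁≡a , _)         = ⊥-elim (e₁≢a e₁≡a)
    ... | no _    | inj₂ (e₁≡v , _)         = sym e₁≡v

  joins⇒opposite : ∀ {f a v} → T (joins G f a v) → v ≡ opposite f a
  joins⇒opposite = opposite-spec ∘ joins-spec

  joins⇒opposite′ : ∀ {f a v} → T (joins G f a v) → a ≡ opposite f v
  joins⇒opposite′ = opposite-spec ∘ Sum.swap ∘ joins-spec

  -- A step (f , v) traverses f forwards iff it arrives at end₂ f; loops count as forwards.
  isForward : Step n m → Bool
  isForward (f , v) = end₂ f =ᵇ v

  source target : Step n m → Fin n
  source s@(f , _) = if isForward s then end₁ f else end₂ f
  target s@(f , _) = if isForward s then end₂ f else end₁ f

  joins⇒source : ∀ {f a v} → T (joins G f a v) → source (f , v) ≡ a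
  joins⇒source {f} {a} {v} j with end₂ f ≟ v | joins-spec j
  ... | yes _    | inj₁ (e₁≡a , _)       = e₁≡a
  ... | yes e₂≡v | inj₂ (e₁≡v , e₂≡a)   = trans e₁≡v (trans (sym e₂≡v) e₂≡a)
  ... | no e₂≢v  | inj₁ (_ , e₂≡v)       = ⊥-elim (e₂≢v e₂≡v)
  ... | no _     | inj₂ (_ , e₂≡a)       = e₂≡a

  joins⇒target : ∀ {f a v} → T (joins G f a v) → target (f , v) ≡ v
  joins⇒target {f} {a} {v} j with end₂ f ≟ v | joins-spec j
  ... | yes e₂≡v | _                     = e₂≡v
  ... | no e₂≢v  | inj₁ (_ , e₂≡v)       = ⊥-elim (e₂≢v e₂≡v)
  ... | no _     | inj₂ (e₁≡v , _)       = e₁≡v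

  forwardAt backwardAt : Step n m → Fin m → ℕ
  forwardAt  s e = χ ((e =ᵇ proj₁ s) ∧ isForward s)
  backwardAt s e = χ ((e =ᵇ proj₁ s) ∧ not (isForward s))

  profileOf : List (Step n m) → Profile m
  profileOf t = ⟨ (λ e → ∑[ s ∈ t ] forwardAt s e) , (λ e → ∑[ s ∈ t ] backwardAt s e) ⟩

  traversals≡ : ∀ e t → traversals e t ≡ forwards (profileOf t) e + backwards (profileOf t) e
  traversals≡ e []            = refl
  traversals≡ e ((f , v) ∷ t) with e ≟ f
  ... | no _  = traversals≡ e t
  ... | yes _ with isForward (f , v)
  ...   | true  = cong suc (traversals≡ e t)
  ...   | false = trans (cong suc (traversals≡ e t)) (sym (+-suc _ _))

  hasProfile : Profile m → List (Step n m) → Bool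
  hasProfile c t = allEq (forwards (profileOf t)) (forwards c) ∧ allEq (backwards (profileOf t)) (backwards c)

  -- The profile left after the step s, with truncated subtraction; it is the right one when allows c s.
  _⊖_ : Profile m → Step n m → Profile m
  c ⊖ s = ⟨ (λ e → forwards c e ∸ forwardAt s e) , (λ e → backwards c e ∸ backwardAt s e) ⟩

  allows : Profile m → Step n m → Bool
  allows c s@(f , _) = (forwardAt s f ≤ᵇ forwards c f) ∧ (backwardAt s f ≤ᵇ backwards c f)

  private
    peel : ∀ c s t → (∀ e → forwardAt s e + forwards (profileOf t) e ≡ forwards c e) →
                     (∀ e → backwardAt s e + backwards (profileOf t) e ≡ backwards c e) →
           T (allows c s) × T (hasProfile (c ⊖ s) t)
    peel c s@(f , _) t fwd bwd =
      ∧-intro (≤⇒≤ᵇ (m+n≤o⇒m≤o (forwardAt s f) (≤-reflexive (fwd f))))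
              (≤⇒≤ᵇ (m+n≤o⇒m≤o (backwardAt s f) (≤-reflexive (bwd f)))) ,
      ∧-intro (allEq-complete _ _ (λ e → sym (trans (cong (_∸ forwardAt s e) (sym (fwd e)))
                                                    (m+n∸m≡n (forwardAt s e) _))))
              (allEq-complete _ _ (λ e → sym (trans (cong (_∸ backwardAt s e) (sym (bwd e)))
                                                    (m+n∸m≡n (backwardAt s e) _))))

  hasProfile-∷ : ∀ c s t → T (hasProfile c (s ∷ t)) → T (allows c s) × T (hasProfile (c ⊖ s) t)
  hasProfile-∷ c s t h = peel c s t (allEq-sound _ _ (proj₁ (∧-elim h))) (allEq-sound _ _ (proj₂ (∧-elim h)))

  hasProfile-∷ʳ : ∀ c s t → T (hasProfile c (t ++ [ s ])) → T (allows c s) × T (hasProfile (c ⊖ s) t)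
  hasProfile-∷ʳ c s t h =
    peel c s t (λ e → trans (last-first (λ s → forwardAt s e)) (allEq-sound _ _ (proj₁ (∧-elim h)) e))
               (λ e → trans (last-first (λ s → backwardAt s e)) (allEq-sound _ _ (proj₂ (∧-elim h)) e))
    where
    last-first : ∀ (g : Step n m → ℕ) → g s + ∑ᴸ t g ≡ ∑ᴸ (t ++ [ s ]) g
    last-first g = sym (trans (∑ᴸ-++ t [ s ] g)
                              (trans (cong (∑ᴸ t g +_) (+-identityʳ (g s))) (+-comm (∑ᴸ t g) (g s))))

  weigh : (Fin m → ℕ) → (Fin m → ℕ) → Fin n → Fin m → ℕ
  weigh X Y w e = χ (end₁ e =ᵇ w) * X e + χ (end₂ e =ᵇ w) * Y e

  weigh-cong : ∀ w e {x x′ y y′} → x ≡ x′ → y ≡ y′ →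
               χ (end₁ e =ᵇ w) * x + χ (end₂ e =ᵇ w) * y ≡ χ (end₁ e =ᵇ w) * x′ + χ (end₂ e =ᵇ w) * y′
  weigh-cong w e = cong₂ (λ x y → χ (end₁ e =ᵇ w) * x + χ (end₂ e =ᵇ w) * y)

  exits entries : Profile m → Fin n → Fin m → ℕ
  exits   c = weigh (forwards c) (backwards c)
  entries c = weigh (backwards c) (forwards c)

  private
    pred-+ : ∀ {x} y → 1 ≤ x → pred x + y ≡ pred (x + y)
    pred-+ {suc _} y _ = refl

    χ-end : ∀ {w a : Fin n} → w ≡ a → χ (w =ᵇ a) ≡ 1
    χ-end w≡a = χ-true (fromWitness w≡a)

  weigh-decrementˡ : ∀ {X X′ Y Y′ a f} → end₁ f ≡ a → 1 ≤ X f →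
    (∀ e → X′ e ≡ updateAt X f pred e) → (∀ e → Y′ e ≡ Y e) → Decrement (weigh X Y) (weigh X′ Y′) a f
  weigh-decrementˡ {X} {X′} {Y} {Y′} {a} {f} e₁≡a 1≤Xf X′≗ Y′≗ = record
    { elsewhere = elsewhere ; at = at ; positive = positive }
    where
    open ≡-Reasoning
    positive : 1 ≤ weigh X Y a f
    positive = ≤-trans 1≤Xf (≤-trans (≤-reflexive (trans (sym (*-identityˡ (X f))) (cong (_* X f) (sym (χ-end e₁≡a)))))
                                      (m≤m+n _ _))
    elsewhere : ∀ w → ¬ w ≡ a → ∀ e → weigh X′ Y′ w e ≡ weigh X Y w e
    elsewhere w w≢a e with e ≟ f
    ... | yes refl rewrite χ-=ᵇ-≢ (λ e₁≡w → w≢a (trans (sym e₁≡w) e₁≡a)) = cong (χ (end₂ e =ᵇ w) *_) (Y′≗ e)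
    ... | no e≢f = weigh-cong w e (trans (X′≗ e) (updateAt-minimal e f X e≢f)) (Y′≗ e)
    at : ∀ e → weigh X′ Y′ a e ≡ updateAt (weigh X Y a) f pred e
    at e with e ≟ f
    ... | yes refl = begin
      χ (end₁ e =ᵇ a) * X′ e + χ (end₂ e =ᵇ a) * Y′ e
        ≡⟨ cong₂ (λ x y → x * X′ e + χ (end₂ e =ᵇ a) * y) (χ-end e₁≡a) (Y′≗ e) ⟩
      1 * X′ e + χ (end₂ e =ᵇ a) * Y e
        ≡⟨ cong (λ x → x + χ (end₂ e =ᵇ a) * Y e) (trans (*-identityˡ (X′ e)) (trans (X′≗ e) (updateAt-updates e X))) ⟩
      pred (X e) + χ (end₂ e =ᵇ a) * Y e
        ≡⟨ pred-+ _ 1≤Xf ⟩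
      pred (X e + χ (end₂ e =ᵇ a) * Y e)
        ≡⟨ cong (λ x → pred (x + χ (end₂ e =ᵇ a) * Y e)) (trans (sym (*-identityˡ (X e))) (cong (_* X e) (sym (χ-end e₁≡a)))) ⟩
      pred (weigh X Y a e)
        ≡⟨ updateAt-updates e (weigh X Y a) ⟨
      updateAt (weigh X Y a) e pred e ∎
    ... | no e≢f = trans (weigh-cong a e (trans (X′≗ e) (updateAt-minimal e f X e≢f)) (Y′≗ e))
                         (sym (updateAt-minimal e f (weigh X Y a) e≢f))

  weigh-decrementʳ : ∀ {X X′ Y Y′ a f} → end₂ f ≡ a → 1 ≤ Y f →
    (∀ e → X′ e ≡ X e) → (∀ e → Y′ e ≡ updateAt Y f pred e) → Decrement (weigh X Y) (weigh X′ Y′) a f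
  weigh-decrementʳ {X} {X′} {Y} {Y′} {a} {f} e₂≡a 1≤Yf X′≗ Y′≗ = record
    { elsewhere = elsewhere ; at = at ; positive = positive }
    where
    open ≡-Reasoning
    positive : 1 ≤ weigh X Y a f
    positive = ≤-trans 1≤Yf (≤-trans (≤-reflexive (trans (sym (*-identityˡ (Y f))) (cong (_* Y f) (sym (χ-end e₂≡a)))))
                                      (m≤n+m _ _))
    elsewhere : ∀ w → ¬ w ≡ a → ∀ e → weigh X′ Y′ w e ≡ weigh X Y w e
    elsewhere w w≢a e with e ≟ f
    ... | yes refl rewrite χ-=ᵇ-≢ (λ e₂≡w → w≢a (trans (sym e₂≡w) e₂≡a)) =
      cong (λ x → χ (end₁ e =ᵇ w) * x + 0) (X′≗ e)
    ... | no e≢f = weigh-cong w e (X′≗ e) (trans (Y′≗ e) (updateAt-minimal e f Y e≢f))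
    at : ∀ e → weigh X′ Y′ a e ≡ updateAt (weigh X Y a) f pred e
    at e with e ≟ f
    ... | yes refl = begin
      χ (end₁ e =ᵇ a) * X′ e + χ (end₂ e =ᵇ a) * Y′ e
        ≡⟨ cong₂ (λ x y → χ (end₁ e =ᵇ a) * x + y * Y′ e) (X′≗ e) (χ-end e₂≡a) ⟩
      χ (end₁ e =ᵇ a) * X e + 1 * Y′ e
        ≡⟨ cong (χ (end₁ e =ᵇ a) * X e +_) (trans (*-identityˡ (Y′ e)) (trans (Y′≗ e) (updateAt-updates e Y))) ⟩
      χ (end₁ e =ᵇ a) * X e + pred (Y e)
        ≡⟨ +-comm _ (pred (Y e)) ⟩
      pred (Y e) + χ (end₁ e =ᵇ a) * X e
        ≡⟨ pred-+ _ 1≤Yf ⟩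
      pred (Y e + χ (end₁ e =ᵇ a) * X e)
        ≡⟨ cong pred (+-comm (Y e) _) ⟩
      pred (χ (end₁ e =ᵇ a) * X e + Y e)
        ≡⟨ cong (λ y → pred (χ (end₁ e =ᵇ a) * X e + y)) (trans (sym (*-identityˡ (Y e))) (cong (_* Y e) (sym (χ-end e₂≡a)))) ⟩
      pred (weigh X Y a e)
        ≡⟨ updateAt-updates e (weigh X Y a) ⟨
      updateAt (weigh X Y a) e pred e ∎
    ... | no e≢f = trans (weigh-cong a e (X′≗ e) (trans (Y′≗ e) (updateAt-minimal e f Y e≢f)))
                         (sym (updateAt-minimal e f (weigh X Y a) e≢f))

  forwardAt-self : ∀ s → forwardAt s (proj₁ s) ≡ χ (isForward s)
  forwardAt-self (f , v) rewrite =ᵇ-refl f = refl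

  backwardAt-self : ∀ s → backwardAt s (proj₁ s) ≡ χ (not (isForward s))
  backwardAt-self (f , v) rewrite =ᵇ-refl f = refl

  forwardAt-other : ∀ s e → ¬ e ≡ proj₁ s → forwardAt s e ≡ 0
  forwardAt-other s e e≢f rewrite =ᵇ-≢ e≢f = refl

  backwardAt-other : ∀ s e → ¬ e ≡ proj₁ s → backwardAt s e ≡ 0
  backwardAt-other s e e≢f rewrite =ᵇ-≢ e≢f = refl

  private
    ∸-decrement : ∀ (X d : Fin m → ℕ) f → d f ≡ 1 → (∀ e → ¬ e ≡ f → d e ≡ 0) →
                  ∀ e → X e ∸ d e ≡ updateAt X f pred e
    ∸-decrement X d f d≡1 d≡0 e with e ≟ f
    ... | yes refl rewrite d≡1 | updateAt-updates e {pred} X = ∸1≡pred (X e)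
      where
      ∸1≡pred : ∀ x → x ∸ 1 ≡ pred x
      ∸1≡pred zero    = refl
      ∸1≡pred (suc x) = refl
    ... | no e≢f rewrite d≡0 e e≢f = sym (updateAt-minimal e f X e≢f)

    ∸-unchanged : ∀ (X d : Fin m → ℕ) f → d f ≡ 0 → (∀ e → ¬ e ≡ f → d e ≡ 0) →
                  ∀ e → X e ∸ d e ≡ X e
    ∸-unchanged X d f d≡0 d≢≡0 e with e ≟ f
    ... | yes refl rewrite d≡0 = refl
    ... | no e≢f rewrite d≢≡0 e e≢f = refl

    forward-count : ∀ c s → T (allows c s) → T (isForward s) → 1 ≤ forwards c (proj₁ s)
    forward-count c s ok fwd =
      subst (_≤ forwards c (proj₁ s)) (trans (forwardAt-self s) (χ-true fwd)) (≤ᵇ⇒≤ _ _ (proj₁ (∧-elim ok)))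

    backward-count : ∀ c s → T (allows c s) → ¬ T (isForward s) → 1 ≤ backwards c (proj₁ s)
    backward-count c s ok bwd =
      subst (_≤ backwards c (proj₁ s)) (trans (backwardAt-self s) (χ-true (¬T⇒T-not bwd))) (≤ᵇ⇒≤ _ _ (proj₂ (∧-elim ok)))

    ⊖-forward : ∀ c s → T (isForward s) →
      (∀ e → forwards (c ⊖ s) e ≡ updateAt (forwards c) (proj₁ s) pred e) ×
      (∀ e → backwards (c ⊖ s) e ≡ backwards c e)
    ⊖-forward c s fwd =
      ∸-decrement (forwards c) (forwardAt s) (proj₁ s) (trans (forwardAt-self s) (χ-true fwd)) (forwardAt-other s) ,
      ∸-unchanged (backwards c) (backwardAt s) (proj₁ s) (trans (backwardAt-self s) (χ-false (T⇒¬T-not fwd))) (backwardAt-other s)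

    ⊖-backward : ∀ c s → ¬ T (isForward s) →
      (∀ e → forwards (c ⊖ s) e ≡ forwards c e) ×
      (∀ e → backwards (c ⊖ s) e ≡ updateAt (backwards c) (proj₁ s) pred e)
    ⊖-backward c s bwd =
      ∸-unchanged (forwards c) (forwardAt s) (proj₁ s) (trans (forwardAt-self s) (χ-false bwd)) (forwardAt-other s) ,
      ∸-decrement (backwards c) (backwardAt s) (proj₁ s) (trans (backwardAt-self s) (χ-true (¬T⇒T-not bwd))) (backwardAt-other s)

  private
    source-fwd : ∀ s → T (isForward s) → end₁ (proj₁ s) ≡ source s
    source-fwd (f , v) fwd with end₂ f ≟ v
    ... | yes _ = refl
    ... | no _  = ⊥-elim fwd

    source-bwd : ∀ s → ¬ T (isForward s) → end₂ (proj₁ s) ≡ source s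
    source-bwd (f , v) bwd with end₂ f ≟ v
    ... | yes _ = ⊥-elim (bwd tt)
    ... | no _  = refl

    target-fwd : ∀ s → T (isForward s) → end₂ (proj₁ s) ≡ target s
    target-fwd (f , v) fwd with end₂ f ≟ v
    ... | yes _ = refl
    ... | no _  = ⊥-elim fwd

    target-bwd : ∀ s → ¬ T (isForward s) → end₁ (proj₁ s) ≡ target s
    target-bwd (f , v) bwd with end₂ f ≟ v
    ... | yes _ = ⊥-elim (bwd tt)
    ... | no _  = refl

  exits-⊖ : ∀ c s → T (allows c s) → Decrement (exits c) (exits (c ⊖ s)) (source s) (proj₁ s)
  exits-⊖ c s ok with T? (isForward s)
  ... | yes fwd = weigh-decrementˡ (source-fwd s fwd) (forward-count c s ok fwd)
                                   (proj₁ (⊖-forward c s fwd)) (proj₂ (⊖-forward c s fwd))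
  ... | no bwd  = weigh-decrementʳ (source-bwd s bwd) (backward-count c s ok bwd)
                                   (proj₁ (⊖-backward c s bwd)) (proj₂ (⊖-backward c s bwd))

  entries-⊖ : ∀ c s → T (allows c s) → Decrement (entries c) (entries (c ⊖ s)) (target s) (proj₁ s)
  entries-⊖ c s ok with T? (isForward s)
  ... | yes fwd = weigh-decrementʳ (target-fwd s fwd) (forward-count c s ok fwd)
                                   (proj₂ (⊖-forward c s fwd)) (proj₁ (⊖-forward c s fwd))
  ... | no bwd  = weigh-decrementˡ (target-bwd s bwd) (backward-count c s ok bwd)
                                   (proj₂ (⊖-backward c s bwd)) (proj₁ (⊖-backward c s bwd))

  -- Counting walks with a given profile

  steps : List (Step n m)
  steps = allSteps n m

  ∑-steps : ∀ g → ∑[ s ∈ steps ] g s ≡ ∑ (λ f → ∑ (λ v → g (f , v)))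
  ∑-steps g = begin
    ∑[ s ∈ steps ] g s                                     ≡⟨ ∑ᴸ-concatMap (allFin m) _ g ⟩
    ∑[ f ∈ allFin m ] ∑[ s ∈ map (f ,_) (allFin n) ] g s   ≡⟨ ∑ᴸ-cong (allFin m) (λ f → ∑ᴸ-map (allFin n) (f ,_) g) ⟩
    ∑[ f ∈ allFin m ] ∑[ v ∈ allFin n ] g (f , v)          ≡⟨ ∑ᴸ-cong (allFin m) (λ f → ∑ᴸ-allFin (λ v → g (f , v))) ⟩
    ∑[ f ∈ allFin m ] ∑ (λ v → g (f , v))                  ≡⟨ ∑ᴸ-allFin (λ f → ∑ (λ v → g (f , v))) ⟩
    ∑ (λ f → ∑ (λ v → g (f , v)))                          ∎
    where open ≡-Reasoning

  isWalk-∷ʳ : ∀ {a b f v} t → T (isWalk G a (t ++ [ (f , v) ]) b) →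
    T (isWalk G a t (opposite f b)) × T (joins G f (opposite f b) b) × v ≡ b
  isWalk-∷ʳ {a} {b} {f} {v} [] w with ∧-elim w
  ... | j , v=b with toWitness {a? = v ≟ b} v=b
  ...   | refl = fromWitness (joins⇒opposite′ j) , subst (λ x → T (joins G f x v)) (joins⇒opposite′ j) j , refl
  isWalk-∷ʳ ((g , u) ∷ t) w with ∧-elim w
  ... | j , w′ with isWalk-∷ʳ t w′
  ...   | w″ , rest = ∧-intro j w″ , rest

  count : ℕ → Fin n → Fin n → Profile m → ℕ
  count l a b c = ∑[ t ∈ allLists steps l ] χ (isWalk G a t b ∧ hasProfile c t)

  private
    χ-∧₃ : ∀ a b c → χ (a ∧ (b ∧ c)) ≡ χ a * (χ b * χ c)
    χ-∧₃ a b c = trans (χ-∧ a (b ∧ c)) (cong (χ a *_) (χ-∧ b c))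

    ∑ᴸ-*ˡ₂ : ∀ {A : Set} (xs : List A) x y g → ∑[ t ∈ xs ] (x * (y * g t)) ≡ x * (y * ∑ᴸ xs g)
    ∑ᴸ-*ˡ₂ xs x y g = sym (trans (cong (x *_) (∑ᴸ-*ˡ xs y g)) (∑ᴸ-*ˡ xs x (λ t → y * g t)))

  count-∷ : ∀ l a b c →
    count (suc l) a b c ≤ ∑ (λ f → ∑ (λ v → χ (joins G f a v) * (χ (allows c (f , v)) * count l v b (c ⊖ (f , v)))))
  count-∷ l a b c = begin
    count (suc l) a b c
      ≡⟨ allLists-∷ steps l _ ⟩
    ∑[ s ∈ steps ] ∑[ t ∈ allLists steps l ] χ (isWalk G a (s ∷ t) b ∧ hasProfile c (s ∷ t))
      ≤⟨ ∑ᴸ-mono steps (λ s → ∑ᴸ-mono (allLists steps l) (first-step s)) ⟩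
    ∑[ s ∈ steps ] ∑[ t ∈ allLists steps l ] split s t
      ≡⟨ ∑ᴸ-cong steps (λ { (f , v) → ∑ᴸ-*ˡ₂ (allLists steps l) (χ (joins G f a v)) (χ (allows c (f , v)))
                                                    (λ t → χ (isWalk G v t b ∧ hasProfile (c ⊖ (f , v)) t)) }) ⟩
    ∑[ s ∈ steps ] R s
      ≡⟨ ∑-steps R ⟩
    ∑ (λ f → ∑ (λ v → R (f , v))) ∎
    where
    open ≤-Reasoning
    split : Step n m → List (Step n m) → ℕ
    split (f , v) t = χ (joins G f a v) * (χ (allows c (f , v)) * χ (isWalk G v t b ∧ hasProfile (c ⊖ (f , v)) t))
    R : Step n m → ℕ
    R (f , v) = χ (joins G f a v) * (χ (allows c (f , v)) * count l v b (c ⊖ (f , v)))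
    first-step : ∀ s t → χ (isWalk G a (s ∷ t) b ∧ hasProfile c (s ∷ t)) ≤ split s t
    first-step s@(f , v) t = ≤-trans (χ-mono unfold) (≤-reflexive (χ-∧₃ (joins G f a v) (allows c s) _))
      where
      unfold : T (isWalk G a (s ∷ t) b ∧ hasProfile c (s ∷ t)) →
             T (joins G f a v ∧ (allows c s ∧ (isWalk G v t b ∧ hasProfile (c ⊖ s) t)))
      unfold w with ∧-elim w
      ... | walk , prof with ∧-elim {joins G f a v} walk | hasProfile-∷ c s t prof
      ...   | j , walk′ | ok , prof′ = ∧-intro j (∧-intro ok (∧-intro walk′ prof′))

  count-∷ʳ : ∀ l a b c →
    count (suc l) a b c ≤ ∑ (λ f → ∑ (λ v → χ ((v =ᵇ b) ∧ joins G f (opposite f b) b)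
                                          * (χ (allows c (f , v)) * count l a (opposite f b) (c ⊖ (f , v)))))
  count-∷ʳ l a b c = begin
    count (suc l) a b c
      ≡⟨ allLists-∷ʳ steps l _ ⟩
    ∑[ t ∈ allLists steps l ] ∑[ s ∈ steps ] χ (isWalk G a (t ++ [ s ]) b ∧ hasProfile c (t ++ [ s ]))
      ≤⟨ ∑ᴸ-mono (allLists steps l) (λ t → ∑ᴸ-mono steps (λ s → last-step s t)) ⟩
    ∑[ t ∈ allLists steps l ] ∑[ s ∈ steps ] split s t
      ≡⟨ ∑ᴸ-comm (allLists steps l) steps (λ t s → split s t) ⟩
    ∑[ s ∈ steps ] ∑[ t ∈ allLists steps l ] split s t
      ≡⟨ ∑ᴸ-cong steps (λ { (f , v) → ∑ᴸ-*ˡ₂ (allLists steps l) (χ ((v =ᵇ b) ∧ joins G f (opposite f b) b))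
                                        (χ (allows c (f , v)))
                                        (λ t → χ (isWalk G a t (opposite f b) ∧ hasProfile (c ⊖ (f , v)) t)) }) ⟩
    ∑[ s ∈ steps ] R s
      ≡⟨ ∑-steps R ⟩
    ∑ (λ f → ∑ (λ v → R (f , v))) ∎
    where
    open ≤-Reasoning
    split : Step n m → List (Step n m) → ℕ
    split (f , v) t = χ ((v =ᵇ b) ∧ joins G f (opposite f b) b)
                    * (χ (allows c (f , v)) * χ (isWalk G a t (opposite f b) ∧ hasProfile (c ⊖ (f , v)) t))
    R : Step n m → ℕ
    R (f , v) = χ ((v =ᵇ b) ∧ joins G f (opposite f b) b) * (χ (allows c (f , v)) * count l a (opposite f b) (c ⊖ (f , v)))
    last-step : ∀ s t → χ (isWalk G a (t ++ [ s ]) b ∧ hasProfile c (t ++ [ s ])) ≤ split s t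
    last-step s@(f , v) t = ≤-trans (χ-mono unfold) (≤-reflexive (χ-∧₃ ((v =ᵇ b) ∧ joins G f (opposite f b) b) (allows c s) _))
      where
      unfold : T (isWalk G a (t ++ [ s ]) b ∧ hasProfile c (t ++ [ s ])) →
             T (((v =ᵇ b) ∧ joins G f (opposite f b) b) ∧ (allows c s ∧ (isWalk G a t (opposite f b) ∧ hasProfile (c ⊖ s) t)))
      unfold w with ∧-elim w
      ... | walk , prof with isWalk-∷ʳ t walk | hasProfile-∷ʳ c s t prof
      ...   | walk′ , j , v≡b | ok , prof′ =
        ∧-intro {(v =ᵇ b) ∧ joins G f (opposite f b) b} (∧-intro {v =ᵇ b} (fromWitness v≡b) j)
                (∧-intro {allows c s} ok (∧-intro {isWalk G a t (opposite f b)} walk′ prof′))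

  arrangements : (Fin n → Fin m → ℕ) → ℕ
  arrangements o = ∏ (λ w → multinomialᶠ (o w))

  private
    count-zero≤arrangements : ∀ a b c o → count 0 a b c ≤ arrangements o
    count-zero≤arrangements a b c o =
      ≤-trans (≤-reflexive (+-identityʳ _))
              (≤-trans (χ≤1 (isWalk G a [] b ∧ hasProfile c [])) (1≤∏ (λ w → 1≤multinomialᶠ (o w))))

    removal-bound : ∀ (o : Profile m → Fin n → Fin m → ℕ) c s x {C} →
      (T (allows c s) → Decrement (o c) (o (c ⊖ s)) x (proj₁ s)) → C ≤ arrangements (o (c ⊖ s)) →
      multinomialᶠ (o c x) * (χ (allows c s) * C) ≤ arrangements (o c) * pascalTerm (o c x) (proj₁ s)
    removal-bound o c s x {C} decrement C≤ with allows c s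
    ... | false = ≤-trans (≤-reflexive (*-zeroʳ (multinomialᶠ (o c x)))) z≤n
    ... | true  = begin
      multinomialᶠ (o c x) * (1 * C)                    ≡⟨ cong (multinomialᶠ (o c x) *_) (*-identityˡ C) ⟩
      multinomialᶠ (o c x) * C                          ≤⟨ *-monoʳ-≤ (multinomialᶠ (o c x)) C≤ ⟩
      multinomialᶠ (o c x) * arrangements (o (c ⊖ s))  ≡⟨ ∏multinomialᶠ-decrement (decrement tt) ⟩
      arrangements (o c) * pascalTerm (o c x) (proj₁ s) ∎
      where open ≤-Reasoning

  count≤arrangements-exits : ∀ l a b c → count l a b c ≤ arrangements (exits c)
  count≤arrangements-exits zero    a b c = count-zero≤arrangements a b c (exits c)
  count≤arrangements-exits (suc l) a b c =
    bound-by-pascal (exits c a) (λ f v → joins G f a v) (λ f → opposite f a) (λ f v → joins⇒opposite)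
      _ (count-∷ l a b c)
      (λ f v j → removal-bound exits c (f , v) a
                   (λ ok → subst (λ x → Decrement _ _ x f) (joins⇒source j) (exits-⊖ c (f , v) ok))
                   (count≤arrangements-exits l v b (c ⊖ (f , v))))

  count≤arrangements-entries : ∀ l a b c → count l a b c ≤ arrangements (entries c)
  count≤arrangements-entries zero    a b c = count-zero≤arrangements a b c (entries c)
  count≤arrangements-entries (suc l) a b c =
    bound-by-pascal (entries c b) lastStep (λ _ → b) (λ f v → toWitness {a? = v ≟ b} ∘ proj₁ ∘ ∧-elim {v =ᵇ b})
      _ (count-∷ʳ l a b c)
      (λ f v isLast → removal-bound entries c (f , v) b
                   (λ ok → subst (λ x → Decrement _ _ x f) (target≡b f v isLast) (entries-⊖ c (f , v) ok))
                   (count≤arrangements-entries l a (opposite f b) (c ⊖ (f , v))))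
    where
    lastStep : Fin m → Fin n → Bool
    lastStep f v = (v =ᵇ b) ∧ joins G f (opposite f b) b
    target≡b : ∀ f v → T (lastStep f v) → target (f , v) ≡ b
    target≡b f v Jfv with ∧-elim Jfv
    ... | v=b , j with toWitness {a? = v ≟ b} v=b
    ...   | refl = joins⇒target j

  -- Balance at the vertices of a closed walk

  private
    χ-if : ∀ b (p q w : Fin n) → χ (p =ᵇ w) * χ b + χ (q =ᵇ w) * χ (not b) ≡ χ ((if b then p else q) =ᵇ w)
    χ-if true  p q w = trans (cong₂ _+_ (*-identityʳ (χ (p =ᵇ w))) (*-zeroʳ (χ (q =ᵇ w)))) (+-identityʳ _)
    χ-if false p q w = trans (cong (_+ χ (q =ᵇ w) * 1) (*-zeroʳ (χ (p =ᵇ w)))) (*-identityʳ (χ (q =ᵇ w)))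

    ∑-weigh-supported : ∀ {X Y} f w → (∀ e → ¬ e ≡ f → X e ≡ 0) → (∀ e → ¬ e ≡ f → Y e ≡ 0) →
                        ∑ (weigh X Y w) ≡ weigh X Y w f
    ∑-weigh-supported {X} {Y} f w X≡0 Y≡0 = ∑-supported (weigh X Y w) f λ e e≢f → begin
      χ (end₁ e =ᵇ w) * X e + χ (end₂ e =ᵇ w) * Y e   ≡⟨ weigh-cong w e (X≡0 e e≢f) (Y≡0 e e≢f) ⟩
      χ (end₁ e =ᵇ w) * 0 + χ (end₂ e =ᵇ w) * 0       ≡⟨ cong₂ _+_ (*-zeroʳ (χ (end₁ e =ᵇ w))) (*-zeroʳ (χ (end₂ e =ᵇ w))) ⟩
      0                                               ∎
      where open ≡-Reasoning

  exits-step : ∀ s w → ∑ (weigh (forwardAt s) (backwardAt s) w) ≡ χ (source s =ᵇ w)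
  exits-step s@(f , v) w = begin
    ∑ (weigh (forwardAt s) (backwardAt s) w)
      ≡⟨ ∑-weigh-supported f w (forwardAt-other s) (backwardAt-other s) ⟩
    χ (end₁ f =ᵇ w) * forwardAt s f + χ (end₂ f =ᵇ w) * backwardAt s f
      ≡⟨ cong₂ (λ x y → χ (end₁ f =ᵇ w) * x + χ (end₂ f =ᵇ w) * y) (forwardAt-self s) (backwardAt-self s) ⟩
    χ (end₁ f =ᵇ w) * χ (isForward s) + χ (end₂ f =ᵇ w) * χ (not (isForward s))
      ≡⟨ χ-if (isForward s) (end₁ f) (end₂ f) w ⟩
    χ (source s =ᵇ w) ∎
    where open ≡-Reasoning

  entries-step : ∀ s w → ∑ (weigh (backwardAt s) (forwardAt s) w) ≡ χ (target s =ᵇ w)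
  entries-step s@(f , v) w = begin
    ∑ (weigh (backwardAt s) (forwardAt s) w)
      ≡⟨ ∑-weigh-supported f w (backwardAt-other s) (forwardAt-other s) ⟩
    χ (end₁ f =ᵇ w) * backwardAt s f + χ (end₂ f =ᵇ w) * forwardAt s f
      ≡⟨ +-comm _ (χ (end₂ f =ᵇ w) * forwardAt s f) ⟩
    χ (end₂ f =ᵇ w) * forwardAt s f + χ (end₁ f =ᵇ w) * backwardAt s f
      ≡⟨ cong₂ (λ x y → χ (end₂ f =ᵇ w) * x + χ (end₁ f =ᵇ w) * y) (forwardAt-self s) (backwardAt-self s) ⟩
    χ (end₂ f =ᵇ w) * χ (isForward s) + χ (end₁ f =ᵇ w) * χ (not (isForward s))
      ≡⟨ χ-if (isForward s) (end₂ f) (end₁ f) w ⟩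
    χ (target s =ᵇ w) ∎
    where open ≡-Reasoning

  private
    weigh-+ : ∀ X₁ Y₁ X₂ Y₂ w e →
      weigh (λ e → X₁ e + X₂ e) (λ e → Y₁ e + Y₂ e) w e ≡ weigh X₁ Y₁ w e + weigh X₂ Y₂ w e
    weigh-+ X₁ Y₁ X₂ Y₂ w e = distrib (χ (end₁ e =ᵇ w)) (χ (end₂ e =ᵇ w)) (X₁ e) (X₂ e) (Y₁ e) (Y₂ e)
      where
      distrib : ∀ a b x₁ x₂ y₁ y₂ → a * (x₁ + x₂) + b * (y₁ + y₂) ≡ (a * x₁ + b * y₁) + (a * x₂ + b * y₂)
      distrib = solve-∀

  ∑-exits-∷ : ∀ s t w → ∑ (exits (profileOf (s ∷ t)) w) ≡ χ (source s =ᵇ w) + ∑ (exits (profileOf t) w)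
  ∑-exits-∷ s t w = begin
    ∑ (exits (profileOf (s ∷ t)) w)
      ≡⟨ ∑-cong (weigh-+ (forwardAt s) (backwardAt s) (forwards (profileOf t)) (backwards (profileOf t)) w) ⟩
    ∑ (λ e → weigh (forwardAt s) (backwardAt s) w e + exits (profileOf t) w e)
      ≡⟨ ∑-distrib-+ (weigh (forwardAt s) (backwardAt s) w) (exits (profileOf t) w) ⟩
    ∑ (weigh (forwardAt s) (backwardAt s) w) + ∑ (exits (profileOf t) w)
      ≡⟨ cong (_+ ∑ (exits (profileOf t) w)) (exits-step s w) ⟩
    χ (source s =ᵇ w) + ∑ (exits (profileOf t) w) ∎
    where open ≡-Reasoning

  ∑-entries-∷ : ∀ s t w → ∑ (entries (profileOf (s ∷ t)) w) ≡ χ (target s =ᵇ w) + ∑ (entries (profileOf t) w)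
  ∑-entries-∷ s t w = begin
    ∑ (entries (profileOf (s ∷ t)) w)
      ≡⟨ ∑-cong (weigh-+ (backwardAt s) (forwardAt s) (backwards (profileOf t)) (forwards (profileOf t)) w) ⟩
    ∑ (λ e → weigh (backwardAt s) (forwardAt s) w e + entries (profileOf t) w e)
      ≡⟨ ∑-distrib-+ (weigh (backwardAt s) (forwardAt s) w) (entries (profileOf t) w) ⟩
    ∑ (weigh (backwardAt s) (forwardAt s) w) + ∑ (entries (profileOf t) w)
      ≡⟨ cong (_+ ∑ (entries (profileOf t) w)) (entries-step s w) ⟩
    χ (target s =ᵇ w) + ∑ (entries (profileOf t) w) ∎
    where open ≡-Reasoning

  -- Each step leaves its source once and enters its target once.
  walk-balance : ∀ a t b → T (isWalk G a t b) → ∀ w →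
    ∑ (exits (profileOf t) w) + χ (b =ᵇ w) ≡ ∑ (entries (profileOf t) w) + χ (a =ᵇ w)
  walk-balance a []            b walk w = cong (λ x → ∑ (exits (profileOf []) w) + χ (x =ᵇ w)) (sym (toWitness walk))
  walk-balance a (s@(f , v) ∷ t) b walk w with ∧-elim walk
  ... | j , walk′ = begin
    ∑ (exits (profileOf (s ∷ t)) w) + χ (b =ᵇ w)
      ≡⟨ cong (_+ χ (b =ᵇ w)) (∑-exits-∷ s t w) ⟩
    χ (source s =ᵇ w) + ∑ (exits (profileOf t) w) + χ (b =ᵇ w)
      ≡⟨ +-assoc (χ (source s =ᵇ w)) _ _ ⟩
    χ (source s =ᵇ w) + (∑ (exits (profileOf t) w) + χ (b =ᵇ w))
      ≡⟨ cong₂ (λ x y → χ (x =ᵇ w) + y) (joins⇒source j) (walk-balance v t b walk′ w) ⟩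
    χ (a =ᵇ w) + (∑ (entries (profileOf t) w) + χ (v =ᵇ w))
      ≡⟨ +-comm (χ (a =ᵇ w)) _ ⟩
    ∑ (entries (profileOf t) w) + χ (v =ᵇ w) + χ (a =ᵇ w)
      ≡⟨ cong (λ x → x + χ (a =ᵇ w)) (trans (+-comm _ (χ (v =ᵇ w))) (cong (λ x → χ (x =ᵇ w) + _) (sym (joins⇒target j)))) ⟩
    χ (target s =ᵇ w) + ∑ (entries (profileOf t) w) + χ (a =ᵇ w)
      ≡⟨ cong (_+ χ (a =ᵇ w)) (∑-entries-∷ s t w) ⟨
    ∑ (entries (profileOf (s ∷ t)) w) + χ (a =ᵇ w) ∎
    where open ≡-Reasoning

  closed-walk-balanced : ∀ {u c t} → T (isWalk G u t u) → T (hasProfile c t) →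
                         ∀ w → ∑ (exits c w) ≡ ∑ (entries c w)
  closed-walk-balanced {u} {c} {t} walk prof w with ∧-elim prof
  ... | F≐ , B≐ = begin
    ∑ (exits c w)                   ≡⟨ ∑-cong (λ e → weigh-cong w e (F e) (B e)) ⟨
    ∑ (exits (profileOf t) w)       ≡⟨ +-cancelʳ-≡ (χ (u =ᵇ w)) _ _ (walk-balance u t u walk w) ⟩
    ∑ (entries (profileOf t) w)     ≡⟨ ∑-cong (λ e → weigh-cong w e (B e) (F e)) ⟩
    ∑ (entries c w)                 ∎
    where
    open ≡-Reasoning
    F = allEq-sound (forwards (profileOf t)) (forwards c) F≐
    B = allEq-sound (backwards (profileOf t)) (backwards c) B≐

  only : ∀ {A : Set} → Bool → A → List A
  only b x = if b then x ∷ [] else []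

  atIncidences : Fin n → (Fin m → ℕ) → (Fin m → ℕ) → List ℕ
  atIncidences w X Y = concatMap (λ e → only (end₁ e =ᵇ w) (X e) ++ only (end₂ e =ᵇ w) (Y e)) (allFin m)

  map-incident : ∀ (k : Fin m → ℕ) w → map k (incident G w) ≡ atIncidences w k k
  map-incident k w = trans (map-concatMap k _ (allFin m))
    (concatMap-cong (λ e → trans (map-++ k (only (end₁ e =ᵇ w) e) (only (end₂ e =ᵇ w) e))
                                 (cong₂ _++_ (map-only (end₁ e =ᵇ w) e) (map-only (end₂ e =ᵇ w) e))) (allFin m))
    where
    map-only : ∀ b e → map k (only b e) ≡ only b (k e)
    map-only true  e = refl
    map-only false e = refl

  PointwiseSum-atIncidences : ∀ {X Y H} w → (∀ e → X e + Y e ≡ H e) →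
    PointwiseSum (atIncidences w X Y) (atIncidences w Y X) (atIncidences w H H)
  PointwiseSum-atIncidences {X} {Y} {H} w X+Y≡H = go (allFin m)
    where
    only-sum : ∀ b {x y z} → x + y ≡ z → PointwiseSum (only b x) (only b y) (only b z)
    only-sum true  eq = eq ∷ []
    only-sum false _  = []
    go : ∀ es → PointwiseSum (concatMap (λ e → only (end₁ e =ᵇ w) (X e) ++ only (end₂ e =ᵇ w) (Y e)) es)
                             (concatMap (λ e → only (end₁ e =ᵇ w) (Y e) ++ only (end₂ e =ᵇ w) (X e)) es)
                             (concatMap (λ e → only (end₁ e =ᵇ w) (H e) ++ only (end₂ e =ᵇ w) (H e)) es)
    go []       = []
    go (e ∷ es) = PointwiseSum-++ (PointwiseSum-++ (only-sum (end₁ e =ᵇ w) (X+Y≡H e))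
                                                   (only-sum (end₂ e =ᵇ w) (trans (+-comm (Y e) (X e)) (X+Y≡H e))))
                                  (go es)

  private
    sum-incidences : ∀ X Y w e → sum (only (end₁ e =ᵇ w) (X e) ++ only (end₂ e =ᵇ w) (Y e)) ≡ weigh X Y w e
    sum-incidences X Y w e = trans (sum-++ (only (end₁ e =ᵇ w) (X e)) _)
                                   (cong₂ _+_ (sum-only (end₁ e =ᵇ w)) (sum-only (end₂ e =ᵇ w)))
      where
      sum-only : ∀ b {x} → sum (only b x) ≡ χ b * x
      sum-only true  = refl
      sum-only false = refl

  sum-atIncidences : ∀ X Y w → sum (atIncidences w X Y) ≡ ∑ (weigh X Y w)
  sum-atIncidences X Y w = begin
    sum (atIncidences w X Y)                       ≡⟨ sum-concatMap _ (allFin m) ⟩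
    ∑[ e ∈ allFin m ] sum (only (end₁ e =ᵇ w) (X e) ++ only (end₂ e =ᵇ w) (Y e))
                                                   ≡⟨ ∑ᴸ-cong (allFin m) (sum-incidences X Y w) ⟩
    ∑[ e ∈ allFin m ] weigh X Y w e                ≡⟨ ∑ᴸ-allFin (weigh X Y w) ⟩
    ∑ (weigh X Y w)                                ∎
    where open ≡-Reasoning

  multinomialᶠ-weigh≤ : ∀ X Y w → multinomialᶠ (weigh X Y w) ≤ multinomial′ (atIncidences w X Y)
  multinomialᶠ-weigh≤ X Y w = begin
    multinomial′ (tabulate (weigh X Y w))
      ≡⟨ cong multinomial′ (tabulate-cong (λ e → sym (sum-incidences X Y w e))) ⟩
    multinomial′ (tabulate (sum ∘ blocks))
      ≡⟨ cong multinomial′ (map-tabulate (λ e → e) (sum ∘ blocks)) ⟨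
    multinomial′ (map (sum ∘ blocks) (allFin m))
      ≤⟨ multinomial′-merge blocks (allFin m) ⟩
    multinomial′ (atIncidences w X Y) ∎
    where
    open ≤-Reasoning
    blocks : Fin m → List ℕ
    blocks e = only (end₁ e =ᵇ w) (X e) ++ only (end₂ e =ᵇ w) (Y e)

  vertexFactor : (Fin m → ℕ) → Fin n → ℕ
  vertexFactor h w = multinomial′ (map (λ e → ⌈ h e /2⌉) (incident G w))

  vertex-bound : ∀ c h → (∀ e → forwards c e + backwards c e ≡ h e) → ∀ w → ∑ (exits c w) ≡ ∑ (entries c w) →
    multinomialᶠ (exits c w) * multinomialᶠ (entries c w) ≤ vertexFactor h w * vertexFactor h w
  vertex-bound c h F+B≡h w balanced = begin
    multinomialᶠ (exits c w) * multinomialᶠ (entries c w)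
      ≤⟨ *-mono-≤ (multinomialᶠ-weigh≤ F B w) (multinomialᶠ-weigh≤ B F w) ⟩
    multinomial′ (atIncidences w F B) * multinomial′ (atIncidences w B F)
      ≤⟨ multinomial′-balanced-split (PointwiseSum-atIncidences w F+B≡h)
           (trans (sum-atIncidences F B w) (trans balanced (sym (sum-atIncidences B F w)))) ⟩
    multinomial′ (map ⌈_/2⌉ (atIncidences w h h)) * multinomial′ (map ⌈_/2⌉ (atIncidences w h h))
      ≡⟨ cong (λ L → multinomial′ L * multinomial′ L) halves ⟩
    vertexFactor h w * vertexFactor h w ∎
    where
    open ≤-Reasoning
    F = forwards c
    B = backwards c
    halves : map ⌈_/2⌉ (atIncidences w h h) ≡ map (λ e → ⌈ h e /2⌉) (incident G w)
    halves = trans (cong (map ⌈_/2⌉) (sym (map-incident h w))) (sym (map-∘ (incident G w)))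

  private
    *-self-cancel-≤ : ∀ {a b} → a * a ≤ b * b → a ≤ b
    *-self-cancel-≤ {a} {b} a²≤b² with a ≤? b
    ... | yes a≤b = a≤b
    ... | no a≰b  = ⊥-elim (<⇒≱ (*-mono-< (≰⇒> a≰b) (≰⇒> a≰b)) a²≤b²)

  count-closed≤ : ∀ l u c h → (∀ e → forwards c e + backwards c e ≡ h e) → count l u u c ≤ ∏ (vertexFactor h)
  count-closed≤ l u c h F+B≡h with all? (λ w → ∑ (exits c w) ≟ℕ ∑ (entries c w))
  ... | yes balanced = *-self-cancel-≤ (begin
    count l u u c * count l u u c
      ≤⟨ *-mono-≤ (count≤arrangements-exits l u u c) (count≤arrangements-entries l u u c) ⟩
    arrangements (exits c) * arrangements (entries c)
      ≡⟨ ∏-distrib-* (λ w → multinomialᶠ (exits c w)) (λ w → multinomialᶠ (entries c w)) ⟨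
    ∏ (λ w → multinomialᶠ (exits c w) * multinomialᶠ (entries c w))
      ≤⟨ ∏-mono (λ w → vertex-bound c h F+B≡h w (balanced w)) ⟩
    ∏ (λ w → vertexFactor h w * vertexFactor h w)
      ≡⟨ ∏-distrib-* (vertexFactor h) (vertexFactor h) ⟩
    ∏ (vertexFactor h) * ∏ (vertexFactor h) ∎)
    where open ≤-Reasoning
  ... | no unbalanced = ≤-trans (≤-reflexive no-closed-walks) z≤n
    where
    no-closed-walks : count l u u c ≡ 0
    no-closed-walks = trans (∑ᴸ-cong (allLists steps l) (λ t → χ-false λ walk-prof →
                               unbalanced (closed-walk-balanced {u} {c} {t} (proj₁ (∧-elim {isWalk G u t u} walk-prof))
                                                                (proj₂ (∧-elim {isWalk G u t u} walk-prof)))))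
                            (∑ᴸ-zero (allLists steps l))

  -- Tours with prescribed traversal counts

  splitProfile : (Fin m → ℕ) → (Fin m → ℕ) → Profile m
  splitProfile h x = ⟨ x , (λ e → h e ∸ x e) ⟩

  tour-profile : ∀ {u t h} → T (isWalk G u t u ∧ allEq (λ i → traversals i t) h) →
    (∀ e → forwards (profileOf t) e ≤ h e) ×
    (∀ x → (∀ e → x e ≡ forwards (profileOf t) e) → T (isWalk G u t u ∧ hasProfile (splitProfile h x) t))
  tour-profile {u} {t} {h} tour with ∧-elim {isWalk G u t u} tour
  ... | walk , trav = (λ e → m+n≤o⇒m≤o (forwards (profileOf t) e) (≤-reflexive (F+B≡h e))) ,
                      (λ x x≗F → ∧-intro walk (∧-intro (allEq-complete _ _ (λ e → sym (x≗F e)))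
                                                       (allEq-complete _ _ (λ e → B≡h∸x x x≗F e))))
    where
    F+B≡h : ∀ e → forwards (profileOf t) e + backwards (profileOf t) e ≡ h e
    F+B≡h e = trans (sym (traversals≡ e t)) (allEq-sound _ _ trav e)
    B≡h∸x : ∀ x → (∀ e → x e ≡ forwards (profileOf t) e) → ∀ e → backwards (profileOf t) e ≡ h e ∸ x e
    B≡h∸x x x≗F e = sym (trans (cong₂ _∸_ (sym (F+B≡h e)) (x≗F e))
                               (m+n∸m≡n (forwards (profileOf t) e) (backwards (profileOf t) e)))

  tour≤∑-box : ∀ u h t → χ (isWalk G u t u ∧ allEq (λ i → traversals i t) h)
                         ≤ ∑[ x ∈ box h ] χ (isWalk G u t u ∧ hasProfile (splitProfile h x) t)
  tour≤∑-box u h t = χ≤ λ tour →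
    box-hit h (forwards (profileOf t)) (proj₁ (tour-profile {u} {t} {h} tour)) _
            (λ x x≗F → ≤-reflexive (sym (χ-true (proj₂ (tour-profile {u} {t} {h} tour) x x≗F))))

  W≤ : ∀ h u → W G h u ≤ ∏ (λ e → suc (h e)) * ∏ (vertexFactor h)
  W≤ h u = begin
    W G h u
      ≡⟨ length-filter _ (allLists steps (total h)) ⟩
    ∑[ t ∈ allLists steps (total h) ] χ (isWalk G u t u ∧ allEq (λ i → traversals i t) h)
      ≤⟨ ∑ᴸ-mono (allLists steps (total h)) (tour≤∑-box u h) ⟩
    ∑[ t ∈ allLists steps (total h) ] ∑[ x ∈ box h ] χ (isWalk G u t u ∧ hasProfile (splitProfile h x) t)
      ≡⟨ ∑ᴸ-comm (allLists steps (total h)) (box h) _ ⟩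
    ∑[ x ∈ box h ] count (total h) u u (splitProfile h x)
      ≤⟨ ∑-box-mono h (λ x x≤h → count-closed≤ (total h) u (splitProfile h x) h (λ e → m+[n∸m]≡n (x≤h e))) ⟩
    ∑[ x ∈ box h ] ∏ (vertexFactor h)
      ≡⟨ ∑-box-const h (∏ (vertexFactor h)) ⟩
    ∏ (λ e → suc (h e)) * ∏ (vertexFactor h) ∎
    where open ≤-Reasoning

  ∏vertexFactor≡ : ∀ h →
    ∏ (vertexFactor h) ≡ product (map (λ v → multinomial (map (λ e → ⌈ h e /2⌉) (incident G v))) (allFin n))
  ∏vertexFactor≡ h = begin
    ∏ (vertexFactor h)
      ≡⟨ ∏-cong (λ v → multinomial′≡multinomial (ks v)) ⟩
    ∏ (λ v → multinomial (ks v))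
      ≡⟨ ∏-tabulate (λ v → multinomial (ks v)) ⟨
    product (tabulate (λ v → multinomial (ks v)))
      ≡⟨ cong product (map-tabulate (λ v → v) (λ v → multinomial (ks v))) ⟨
    product (map (λ v → multinomial (ks v)) (allFin n)) ∎
    where
    open ≡-Reasoning
    ks : Fin n → List ℕ
    ks v = map (λ e → ⌈ h e /2⌉) (incident G v)

2*⌈/2⌉-bounds : ∀ h → h ≤ 2 * ⌈ h /2⌉ × 2 * ⌈ h /2⌉ ≤ suc h
2*⌈/2⌉-bounds zero          = z≤n , z≤n
2*⌈/2⌉-bounds (suc zero)    = s≤s z≤n , ≤-refl
2*⌈/2⌉-bounds (suc (suc h)) with 2*⌈/2⌉-bounds h
... | lower , upper = subst (suc (suc h) ≤_) (sym double) (s≤s (s≤s lower)) ,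
                      subst (_≤ suc (suc (suc h))) (sym double) (s≤s (s≤s upper))
  where
  double : 2 * ⌈ suc (suc h) /2⌉ ≡ suc (suc (2 * ⌈ h /2⌉))
  double = cong suc (+-suc ⌈ h /2⌉ (⌈ h /2⌉ + 0))

suc≤+2* : ∀ {m} x → Fin m → suc x ≤ x + 2 * m
suc≤+2* {suc m} x _ = subst (_≤ x + 2 * suc m) (+-comm x 1) (+-monoʳ-≤ x (s≤s z≤n))

∏suc≤^ : ∀ {m} (h : Fin m → ℕ) → ∏ (λ e → suc (h e)) ≤ (total h + 2 * m) ^ m
∏suc≤^ h = ∏-≤-^ λ e →
  ≤-trans (s≤s (≤-trans (≤-∑ h e) (≤-reflexive (sym (∑ᴸ-allFin h))))) (suc≤+2* (total h) e)

lemma2p5 : {n m : ℕ} (G : Graph n m) → Connected G → (u : Fin n) → (h : Fin m → ℕ) →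
    Σ (Fin m → ℕ) (λ k →
      ((i : Fin m) → (h i ≤ 2 * k i) × (2 * k i ≤ h i + 2 * m))
      × (W G h u ≤ (total h + 2 * m) ^ m * product (map (λ v → multinomial (map k (incident G v))) (allFin n))))
lemma2p5 {n} {m} G _ u h = k , k-bounds , (begin
  W G h u
    ≤⟨ W≤ h u ⟩
  ∏ (λ e → suc (h e)) * ∏ (vertexFactor h)
    ≤⟨ *-monoˡ-≤ (∏ (vertexFactor h)) (∏suc≤^ h) ⟩
  (total h + 2 * m) ^ m * ∏ (vertexFactor h)
    ≡⟨ cong ((total h + 2 * m) ^ m *_) (∏vertexFactor≡ h) ⟩
  (total h + 2 * m) ^ m * product (map (λ v → multinomial (map k (incident G v))) (allFin n)) ∎)
  where
  open Walks G
  open ≤-Reasoning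
  k : Fin m → ℕ
  k e = ⌈ h e /2⌉
  k-bounds : ∀ i → (h i ≤ 2 * k i) × (2 * k i ≤ h i + 2 * m)
  k-bounds i = proj₁ (2*⌈/2⌉-bounds (h i)) , ≤-trans (proj₂ (2*⌈/2⌉-bounds (h i))) (suc≤+2* (h i) i)
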